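{- Let $p\geq5$ be a prime, $k$ odd, $q=p^k$, $G_q=\mathrm{PSL}(2,q)$. Let $\mathcal{C}_p$ be the set of elements of order $p$ in $G_q$ and $\Gamma_q$ the graph on $\mathcal{C}_p$ where distinct $g,h$ are adjacent iff $hg^{ -1}\in\mathcal{C}_p$. For $a\in\mathbb{F}_q$ let $T_a$ be the image of $\begin{pmatrix}1&a\\0&1\end{pmatrix}$, $R=T_1$, $\mathrm{C}=\{T_a:a\in\mathbb{F}_q\}$, and $\mathscr{C}=\{\text{image of }\begin{pmatrix}1+4b&-4b^2\\4&1-4b\end{pmatrix} : b\in\mathbb{F}_q\}$. Let $\widetilde\Gamma_q$ be the subgraph of $\Gamma_q$ induced by the neighbourhood $N_{\Gamma_q}(R)=(\mathrm{C}\setminus\{I,R\})\cup\mathscr{C}$. Then $\widetilde\Gamma_q$ is the disjoint union (with no edges between them) of the induced subgraph $\Gamma_q[\mathrm{C}\setminus\{I,R\}]$, which is a clique of size $q-2$, and the induced subgraph $\Gamma_q[\mathscr{C}]$. Moreover, if $q\equiv1\pmod 4$ then $\Gamma_q[\mathscr{C}]$ is a disjoint union of $q/p$ cycles of length $p$, and if $q\equiv 3\pmod 4$ then $\Gamma_q[\mathscr{C}]$ has no edges. Consequently the clique number of $\widetilde\Gamma_q$ is $q-2$. -}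

module Defs where

open import Level using (Level; _⊔_)
open import Algebra.Bundles using (CommutativeRing)
open import Data.Nat using (ℕ; zero; suc; _<_; _≤_; _∸_; _^_)
open import Data.Nat.DivMod using (_%_; m%n<n)
open import Data.Nat.Primality using (Prime)
open import Data.Fin using (Fin; toℕ; fromℕ<)
open import Data.Product using (Σ; ∃; _×_; _,_)
open import Data.Sum using (_⊎_)
open import Relation.Nullary using (¬_)
open import Relation.Binary.PropositionalEquality using (_≡_)

record IsField {c ℓ : Level} (F : CommutativeRing c ℓ) : Set (c ⊔ ℓ) where
  open CommutativeRing F
  field
    1≉0 : ¬ (1# ≈ 0#)
    inverse : ∀ x → ¬ (x ≈ 0#) → ∃ λ y → x * y ≈ 1#

HasCard : {c ℓ : Level} (F : CommutativeRing c ℓ) → ℕ → Set (c ⊔ ℓ)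
HasCard F q = Σ (Fin q → Carrier) λ e →
    (∀ i j → e i ≈ e j → i ≡ j) × (∀ x → ∃ λ i → e i ≈ x)
  where open CommutativeRing F

next : ∀ {n} → Fin (suc n) → Fin (suc n)
next {n} i = fromℕ< (m%n<n (suc (toℕ i)) (suc n))

module PSL2 {c ℓ : Level} (F : CommutativeRing c ℓ) where
  open CommutativeRing F

  record Mat : Set c where
    constructor mat
    field
      m₁₁ m₁₂ m₂₁ m₂₂ : Carrier

  open Mat public

  det : Mat → Carrier
  det g = m₁₁ g * m₂₂ g - m₁₂ g * m₂₁ g

  InSL : Mat → Set ℓ
  InSL g = det g ≈ 1#

  I : Mat
  I = mat 1# 0# 0# 1#

  infixl 7 _·_
  _·_ : Mat → Mat → Mat
  g · h = mat (m₁₁ g * m₁₁ h + m₁₂ g * m₂₁ h) (m₁₁ g * m₁₂ h + m₁₂ g * m₂₂ h)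
              (m₂₁ g * m₁₁ h + m₂₂ g * m₂₁ h) (m₂₁ g * m₁₂ h + m₂₂ g * m₂₂ h)

  -- inverse of a determinant-one matrix (the adjugate)
  inv : Mat → Mat
  inv g = mat (m₂₂ g) (- m₁₂ g) (- m₂₁ g) (m₁₁ g)

  _^ᴹ_ : Mat → ℕ → Mat
  g ^ᴹ zero = I
  g ^ᴹ suc n = g · (g ^ᴹ n)

  -- equality in PSL(2,F) = SL(2,F)/{±I}: equal up to sign
  _≈P_ : Mat → Mat → Set ℓ
  g ≈P h = (m₁₁ g ≈ m₁₁ h × m₁₂ g ≈ m₁₂ h × m₂₁ g ≈ m₂₁ h × m₂₂ g ≈ m₂₂ h)
         ⊎ (m₁₁ g ≈ - m₁₁ h × m₁₂ g ≈ - m₁₂ h × m₂₁ g ≈ - m₂₁ h × m₂₂ g ≈ - m₂₂ h)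

  HasOrder : Mat → ℕ → Set ℓ
  HasOrder g n = 0 < n × (g ^ᴹ n) ≈P I × (∀ m → 0 < m → m < n → ¬ ((g ^ᴹ m) ≈P I))

  InCp : ℕ → Mat → Set ℓ
  InCp p g = InSL g × HasOrder g p

  Adj : ℕ → Mat → Mat → Set ℓ
  Adj p g h = ¬ (g ≈P h) × InCp p (h · inv g)

  two four : Carrier
  two = 1# + 1#
  four = two + two

  T : Carrier → Mat
  T x = mat 1# x 0# 1#

  R : Mat
  R = T 1#

  S : Carrier → Mat
  S x = mat (1# + four * x) (- (four * (x * x))) four (1# - four * x)

  InC∖IR : Mat → Set (c ⊔ ℓ)
  InC∖IR g = (∃ λ x → g ≈P T x) × ¬ (g ≈P I) × ¬ (g ≈P R)

  InScrC : Mat → Set (c ⊔ ℓ)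
  InScrC g = ∃ λ x → g ≈P S x

  InΓ̃ : Mat → Set (c ⊔ ℓ)
  InΓ̃ g = InC∖IR g ⊎ InScrC g

  Enumerates : {A : Set} → (Mat → Set (c ⊔ ℓ)) → (A → Mat) → Set (c ⊔ ℓ)
  Enumerates P f = (∀ i → P (f i)) × (∀ i j → f i ≈P f j → i ≡ j)
                 × (∀ g → P g → ∃ λ i → g ≈P f i)

  HasSize : (Mat → Set (c ⊔ ℓ)) → ℕ → Set (c ⊔ ℓ)
  HasSize P n = Σ (Fin n → Mat) λ f → Enumerates P f

  IsClique : ℕ → (Mat → Set (c ⊔ ℓ)) → Set (c ⊔ ℓ)
  IsClique p P = ∀ g h → P g → P h → ¬ (g ≈P h) → Adj p g h

  CliquesAtMost : ℕ → (Mat → Set (c ⊔ ℓ)) → ℕ → Set (c ⊔ ℓ)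
  CliquesAtMost p P n = ∀ m (f : Fin m → Mat) → (∀ i → P (f i))
    → (∀ i j → f i ≈P f j → i ≡ j)
    → (∀ i j → ¬ (i ≡ j) → Adj p (f i) (f j))
    → m ≤ n

  -- Γ_q[𝒞] is a disjoint union of m cycles of length p (p = suc p'):
  -- vertex (i , j) is adjacent exactly to (i , j ± 1 mod p)
  CycleUnion : ℕ → (Mat → Set (c ⊔ ℓ)) → ℕ → Set (c ⊔ ℓ)
  CycleUnion p P m = ∃ λ p' → p ≡ suc p' ×
    (Σ (Fin m × Fin (suc p') → Mat) λ f →
       Enumerates P f
       × (∀ i j i' j' → (Adj p (f (i , j)) (f (i' , j'))
                         → i ≡ i' × (j' ≡ next j ⊎ j ≡ next j'))
                      × (i ≡ i' × (j' ≡ next j ⊎ j ≡ next j')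
                         → Adj p (f (i , j)) (f (i' , j')))))

module Submission where

-- An element g ≠ ±I of SL(2, q) has order p in PSL(2, q) exactly when tr g = ±2: writing g = s + N with N² = δ,
-- Frobenius gives gᵖ = sᵖ + δ^((p-1)/2) N, which is ±I only if δ = s² - 1 = 0. So the neighbours of R are the g with
-- tr g = ±2 and tr (g R⁻¹) = ±2, and solving these equations gives exactly the T x and the S b. Traces of quotients
-- then give the edges: any two T x are adjacent, T x and S b never are, and S a ~ S b iff (2 (b - a))² = -1. For
-- q ≡ 3 (mod 4) -1 is not a square, so 𝒞 has no edges; for q ≡ 1 (mod 4) the edges of 𝒞 join b to b ± i/2 where
-- i² = -1, and the orbits of translation by i/2 are p-cycles. No three elements pairwise differ by ±i/2, so cliques
-- meeting 𝒞 have at most two vertices.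

open import Level using (Level)
open import Algebra.Bundles using (CommutativeRing; CommutativeSemiring; CommutativeMonoid)
open import Data.Empty using (⊥; ⊥-elim)
open import Data.Fin as Fin using (Fin; toℕ; fromℕ; fromℕ<; inject₁; punchIn; punchOut; combine; remQuot)
import Data.Fin.Properties as FinP
open import Data.Fin.Permutation using (Permutation; permutation)
open import Data.Integer as ℤ using (ℤ; +_; -[1+_]; _⊖_)
import Data.Integer.Properties as ℤP
open import Data.List as List using (List; []; _∷_; length)
open import Data.List.Membership.Propositional using (_∈_)
open import Data.List.Membership.Propositional.Properties using (∈-lookup; ∈-filter⁺; ∈-allFin)
open import Data.List.Relation.Unary.All as All using (All; []; _∷_)
open import Data.List.Relation.Unary.All.Properties using (all-filter)
open import Data.List.Relation.Unary.AllPairs using (_∷_)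
open import Data.List.Relation.Unary.Any as Any using ()
open import Data.List.Relation.Unary.Any.Properties using (lookup-index)
open import Data.List.Relation.Unary.Unique.Propositional using (Unique)
import Data.List.Relation.Unary.Unique.Propositional.Properties as Unique
open import Data.Maybe using (Maybe; just; nothing)
open import Data.Nat as ℕ using (ℕ; zero; suc; _≤_; _<_; _∸_; _%_; _/_; z≤n; s≤s; NonZero)
import Data.Nat.Properties as ℕP
open import Data.Nat.Combinatorics using (_C_; nC1≡n; nCn≡1; nCk+nC[k+1]≡[n+1]C[k+1])
open import Data.Nat.Coprimality using (coprime-Bézout; prime⇒coprime)
open import Data.Nat.Divisibility using (_∣_; divides; ∣⇒≤; m∣m*n)
open import Data.Nat.DivMod using (m≡m%n+[m/n]*n; m%n<n)
open import Data.Nat.GCD using (module Bézout)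
open import Data.Nat.Primality using (Prime; prime⇒nonZero; prime⇒irreducible; euclidsLemma)
open import Data.Nat.Solver using (module +-*-Solver)
open import Data.Product using (∃; _×_; _,_; proj₁; proj₂; uncurry)
open import Data.Sum using (_⊎_; inj₁; inj₂; [_,_])
open import Function using (_∘_; flip)
open import Function.Bundles using (_⇔_; mk⇔)
open import Relation.Binary.Definitions using (Decidable)
open import Relation.Binary.PropositionalEquality as ≡ using (_≡_; _≢_)
open import Relation.Nullary using (¬_; Dec; yes; no)

open import Defs

module IntegerCoefficients {c ℓ} (R : CommutativeRing c ℓ) where

  open CommutativeRing R
  open import Relation.Binary.Reasoning.Setoid setoid
  open import Algebra.Properties.Ring ring using (-‿involutive; -‿distribˡ-*; -‿distribʳ-*; -0#≈0#; -‿anti-homo-+)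
  open import Algebra.Definitions.RawMonoid +-rawMonoid using (_×′_)
  open import Algebra.Properties.Semiring.Mult.TCOptimised semiring using (1+×; ×-homo-+; ×1-homo-*)
  open import Algebra.Solver.Ring.AlmostCommutativeRing using (fromCommutativeRing; _-Raw-AlmostCommutative⟶_)
  import Algebra.Solver.Ring

  ι : ℕ → Carrier
  ι n = n ×′ 1#

  CharDivides : ℕ → Set ℓ
  CharDivides n = ι n ≈ 0#

  ι-suc : ∀ n → ι (suc n) ≈ 1# + ι n
  ι-suc n = 1+× n 1#

  ι-+ : ∀ m n → ι (m ℕ.+ n) ≈ ι m + ι n
  ι-+ m n = ×-homo-+ 1# m n

  ι-* : ∀ m n → ι (m ℕ.* n) ≈ ι m * ι n
  ι-* = ×1-homo-*

  ιℤ : ℤ → Carrier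
  ιℤ (+ n) = ι n
  ιℤ -[1+ n ] = - ι (suc n)

  ιℤ-⊖ : ∀ m n → ιℤ (m ⊖ n) ≈ ι m - ι n
  ιℤ-⊖ zero zero = sym (-‿inverseʳ 0#)
  ιℤ-⊖ zero (suc n) = sym (+-identityˡ _)
  ιℤ-⊖ (suc m) zero = sym (trans (+-congˡ -0#≈0#) (+-identityʳ _))
  ιℤ-⊖ (suc m) (suc n) = begin
    ιℤ (suc m ⊖ suc n)      ≡⟨ ≡.cong ιℤ (ℤP.[1+m]⊖[1+n]≡m⊖n m n) ⟩
    ιℤ (m ⊖ n)              ≈⟨ ιℤ-⊖ m n ⟩
    ι m - ι n               ≈⟨ shift ⟩
    (1# + ι m) - (1# + ι n) ≈⟨ +-cong (sym (ι-suc m)) (-‿cong (sym (ι-suc n))) ⟩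
    ι (suc m) - ι (suc n)   ∎
    where
    shift : ι m - ι n ≈ (1# + ι m) - (1# + ι n)
    shift = begin
      ι m - ι n                     ≈⟨ sym (+-identityˡ _) ⟩
      0# + (ι m - ι n)              ≈⟨ +-congʳ (sym (-‿inverseʳ 1#)) ⟩
      (1# - 1#) + (ι m - ι n)       ≈⟨ +-assoc _ _ _ ⟩
      1# + (- 1# + (ι m - ι n))     ≈⟨ +-congˡ (sym (+-assoc _ _ _)) ⟩
      1# + ((- 1# + ι m) - ι n)     ≈⟨ +-congˡ (+-congʳ (+-comm _ _)) ⟩
      1# + ((ι m - 1#) - ι n)       ≈⟨ +-congˡ (+-assoc _ _ _) ⟩
      1# + (ι m + (- 1# - ι n))     ≈⟨ sym (+-assoc _ _ _) ⟩
      (1# + ι m) + (- 1# - ι n)     ≈⟨ +-congˡ (sym (-‿anti-homo-+ _ _)) ⟩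
      (1# + ι m) + - (ι n + 1#)     ≈⟨ +-congˡ (-‿cong (+-comm _ _)) ⟩
      (1# + ι m) - (1# + ι n)       ∎

  ιℤ-neg : ∀ i → ιℤ (ℤ.- i) ≈ - ιℤ i
  ιℤ-neg (+ zero) = sym -0#≈0#
  ιℤ-neg (+ suc n) = refl
  ιℤ-neg -[1+ n ] = sym (-‿involutive _)

  ιℤ-+ : ∀ i j → ιℤ (i ℤ.+ j) ≈ ιℤ i + ιℤ j
  ιℤ-+ (+ m) (+ n) = ι-+ m n
  ιℤ-+ (+ m) -[1+ n ] = ιℤ-⊖ m (suc n)
  ιℤ-+ -[1+ m ] (+ n) = trans (ιℤ-⊖ n (suc m)) (+-comm _ _)
  ιℤ-+ -[1+ m ] -[1+ n ] = begin
    - ι (suc (suc (m ℕ.+ n))) ≡⟨ ≡.cong (λ k → - ι (suc k)) (≡.sym (ℕP.+-suc m n)) ⟩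
    - ι (suc m ℕ.+ suc n)     ≈⟨ -‿cong (ι-+ (suc m) (suc n)) ⟩
    - (ι (suc m) + ι (suc n)) ≈⟨ -‿anti-homo-+ _ _ ⟩
    - ι (suc n) - ι (suc m)   ≈⟨ +-comm _ _ ⟩
    - ι (suc m) - ι (suc n)   ∎

  ιℤ-+* : ∀ m j → ιℤ (+ m ℤ.* j) ≈ ι m * ιℤ j
  ιℤ-+* m (+ n) = trans (reflexive (≡.cong ιℤ (≡.sym (ℤP.pos-* m n)))) (ι-* m n)
  ιℤ-+* m -[1+ n ] = begin
    ιℤ (+ m ℤ.* ℤ.- (+ suc n))  ≡⟨ ≡.cong ιℤ (≡.sym (ℤP.neg-distribʳ-* (+ m) (+ suc n))) ⟩
    ιℤ (ℤ.- (+ m ℤ.* + suc n))  ≈⟨ ιℤ-neg (+ m ℤ.* + suc n) ⟩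
    - ιℤ (+ m ℤ.* + suc n)      ≈⟨ -‿cong (ιℤ-+* m (+ suc n)) ⟩
    - (ι m * ι (suc n))         ≈⟨ -‿distribʳ-* _ _ ⟩
    ι m * - ι (suc n)           ∎

  ιℤ-* : ∀ i j → ιℤ (i ℤ.* j) ≈ ιℤ i * ιℤ j
  ιℤ-* (+ m) j = ιℤ-+* m j
  ιℤ-* -[1+ m ] j = begin
    ιℤ (ℤ.- (+ suc m) ℤ.* j)  ≡⟨ ≡.cong ιℤ (≡.sym (ℤP.neg-distribˡ-* (+ suc m) j)) ⟩
    ιℤ (ℤ.- (+ suc m ℤ.* j))  ≈⟨ ιℤ-neg (+ suc m ℤ.* j) ⟩
    - ιℤ (+ suc m ℤ.* j)      ≈⟨ -‿cong (ιℤ-+* (suc m) j) ⟩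
    - (ι (suc m) * ιℤ j)      ≈⟨ -‿distribˡ-* _ _ ⟩
    - ι (suc m) * ιℤ j        ∎

  ιℤ-homomorphism : ℤ.+-*-rawRing -Raw-AlmostCommutative⟶ fromCommutativeRing R
  ιℤ-homomorphism = record
    { ⟦_⟧ = ιℤ ; +-homo = ιℤ-+ ; *-homo = ιℤ-* ; -‿homo = ιℤ-neg ; 0-homo = refl ; 1-homo = refl }

  ιℤ-≟ : ∀ i j → Maybe (ιℤ i ≈ ιℤ j)
  ιℤ-≟ i j with i ℤ.≟ j
  ... | yes ≡.refl = just refl
  ... | no _ = nothing

  open Algebra.Solver.Ring ℤ.+-*-rawRing (fromCommutativeRing R) ιℤ-homomorphism ιℤ-≟ public
    using (solve; _:+_; _:*_; _:-_; :-_; _:=_; con)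


module DecidableField {c ℓ} (F : CommutativeRing c ℓ) (isField : IsField F)
                      (_≟_ : Decidable (CommutativeRing._≈_ F)) where

  open CommutativeRing F
  open IsField isField public
  open IntegerCoefficients F public
  open import Relation.Binary.Reasoning.Setoid setoid public
  open import Algebra.Properties.Ring ring public using (-‿involutive; -‿distribˡ-*; -‿distribʳ-*; -0#≈0#)
  open import Algebra.Properties.Group +-group public using (x∙y⁻¹≈ε⇒x≈y; x≈y⇒x∙y⁻¹≈ε)
  open import Algebra.Properties.Semiring.Exp semiring public using (_^_; ^-congˡ; ^-homo-*; ^-assocʳ)

  recip : ∀ x → ¬ (x ≈ 0#) → Carrier
  recip x x≉0 = proj₁ (inverse x x≉0)

  *-recip : ∀ x (x≉0 : ¬ (x ≈ 0#)) → x * recip x x≉0 ≈ 1#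
  *-recip x x≉0 = proj₂ (inverse x x≉0)

  x*y≈0⇒x≈0⊎y≈0 : ∀ {x y} → x * y ≈ 0# → x ≈ 0# ⊎ y ≈ 0#
  x*y≈0⇒x≈0⊎y≈0 {x} {y} xy≈0 with x ≟ 0#
  ... | yes x≈0 = inj₁ x≈0
  ... | no x≉0 = inj₂ (begin
    y                ≈⟨ sym (*-identityˡ y) ⟩
    1# * y           ≈⟨ *-congʳ (sym (*-recip x x≉0)) ⟩
    (x * x⁻¹) * y    ≈⟨ solve 3 (λ x x⁻¹ y → (x :* x⁻¹) :* y := x⁻¹ :* (x :* y)) refl x x⁻¹ y ⟩
    x⁻¹ * (x * y)    ≈⟨ *-congˡ xy≈0 ⟩
    x⁻¹ * 0#         ≈⟨ zeroʳ x⁻¹ ⟩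
    0#               ∎)
    where x⁻¹ = recip x x≉0

  x*y≉0 : ∀ {x y} → ¬ (x ≈ 0#) → ¬ (y ≈ 0#) → ¬ (x * y ≈ 0#)
  x*y≉0 x≉0 y≉0 xy≈0 with x*y≈0⇒x≈0⊎y≈0 xy≈0
  ... | inj₁ x≈0 = x≉0 x≈0
  ... | inj₂ y≈0 = y≉0 y≈0

  x≉0∧x*y≈0⇒y≈0 : ∀ {x y} → ¬ (x ≈ 0#) → x * y ≈ 0# → y ≈ 0#
  x≉0∧x*y≈0⇒y≈0 x≉0 xy≈0 with x*y≈0⇒x≈0⊎y≈0 xy≈0
  ... | inj₁ x≈0 = ⊥-elim (x≉0 x≈0)
  ... | inj₂ y≈0 = y≈0

  x*x≈0⇒x≈0 : ∀ {x} → x * x ≈ 0# → x ≈ 0#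
  x*x≈0⇒x≈0 xx≈0 with x*y≈0⇒x≈0⊎y≈0 xx≈0
  ... | inj₁ x≈0 = x≈0
  ... | inj₂ x≈0 = x≈0

  *-cancelˡ : ∀ {x y z} → ¬ (x ≈ 0#) → x * y ≈ x * z → y ≈ z
  *-cancelˡ {x} {y} {z} x≉0 xy≈xz = x∙y⁻¹≈ε⇒x≈y _ _ (x≉0∧x*y≈0⇒y≈0 x≉0 (begin
    x * (y - z)    ≈⟨ solve 3 (λ x y z → x :* (y :- z) := x :* y :- x :* z) refl x y z ⟩
    x * y - x * z  ≈⟨ +-congʳ xy≈xz ⟩
    x * z - x * z  ≈⟨ -‿inverseʳ (x * z) ⟩
    0#             ∎))

  x*x≈y*y⇒x≈y⊎x≈-y : ∀ {x y} → x * x ≈ y * y → x ≈ y ⊎ x ≈ - y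
  x*x≈y*y⇒x≈y⊎x≈-y {x} {y} xx≈yy with x*y≈0⇒x≈0⊎y≈0 (begin
    (x - y) * (x + y)  ≈⟨ solve 2 (λ x y → (x :- y) :* (x :+ y) := x :* x :- y :* y) refl x y ⟩
    x * x - y * y      ≈⟨ +-congʳ xx≈yy ⟩
    y * y - y * y      ≈⟨ -‿inverseʳ (y * y) ⟩
    0#                 ∎)
  ... | inj₁ x-y≈0 = inj₁ (x∙y⁻¹≈ε⇒x≈y _ _ x-y≈0)
  ... | inj₂ x+y≈0 = inj₂ (x∙y⁻¹≈ε⇒x≈y _ _ (trans (+-congˡ (-‿involutive y)) x+y≈0))

  x^n≉0 : ∀ {x} n → ¬ (x ≈ 0#) → ¬ (x ^ n ≈ 0#)
  x^n≉0 zero x≉0 = 1≉0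
  x^n≉0 (suc n) x≉0 = x*y≉0 x≉0 (x^n≉0 n x≉0)

  x^n≈0⇒x≈0 : ∀ {x} n → x ^ n ≈ 0# → x ≈ 0#
  x^n≈0⇒x≈0 {x} n xⁿ≈0 with x ≟ 0#
  ... | yes x≈0 = x≈0
  ... | no x≉0 = ⊥-elim (x^n≉0 n x≉0 xⁿ≈0)

  module PrimeCharacteristic {p : ℕ} (p-prime : Prime p) (ιp≈0 : ι p ≈ 0#) where

    instance
      p≢0 : NonZero p
      p≢0 = prime⇒nonZero p-prime

    ιb≈ιd≈0⇒1+a*b≢c*d : ∀ a b c d → ι b ≈ 0# → ι d ≈ 0# → 1 ℕ.+ a ℕ.* b ≢ c ℕ.* d
    ιb≈ιd≈0⇒1+a*b≢c*d a b c d ιb≈0 ιd≈0 eq = 1≉0 (begin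
      1#                    ≈⟨ solve 1 (λ a → con (+ 1) := con (+ 1) :+ a :* con (+ 0)) refl (ι a) ⟩
      1# + ι a * 0#         ≈⟨ +-congˡ (*-congˡ (sym ιb≈0)) ⟩
      1# + ι a * ι b        ≈⟨ +-congˡ (sym (ι-* a b)) ⟩
      1# + ι (a ℕ.* b)      ≈⟨ sym (ι-suc (a ℕ.* b)) ⟩
      ι (1 ℕ.+ a ℕ.* b)     ≡⟨ ≡.cong ι eq ⟩
      ι (c ℕ.* d)           ≈⟨ ι-* c d ⟩
      ι c * ι d             ≈⟨ *-congˡ ιd≈0 ⟩
      ι c * 0#              ≈⟨ zeroʳ (ι c) ⟩
      0#                    ∎)

    ι≉0 : ∀ {n} → 0 < n → n < p → ¬ (ι n ≈ 0#)
    ι≉0 {n@(suc _)} _ n<p ιn≈0 with coprime-Bézout (prime⇒coprime p-prime n<p)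
    ... | Bézout.+- x y eq = ιb≈ιd≈0⇒1+a*b≢c*d y n x p ιn≈0 ιp≈0 eq
    ... | Bézout.-+ x y eq = ιb≈ιd≈0⇒1+a*b≢c*d x p y n ιp≈0 ιn≈0 eq

    ι-% : ∀ n → ι n ≈ ι (n % p)
    ι-% n = begin
      ι n                                  ≡⟨ ≡.cong ι (m≡m%n+[m/n]*n n p) ⟩
      ι (n % p ℕ.+ (n / p) ℕ.* p)          ≈⟨ ι-+ (n % p) ((n / p) ℕ.* p) ⟩
      ι (n % p) + ι ((n / p) ℕ.* p)        ≈⟨ +-congˡ (ι-* (n / p) p) ⟩
      ι (n % p) + ι (n / p) * ι p          ≈⟨ +-congˡ (*-congˡ ιp≈0) ⟩
      ι (n % p) + ι (n / p) * 0#           ≈⟨ solve 2 (λ a b → a :+ b :* con (+ 0) := a) refl (ι (n % p)) (ι (n / p)) ⟩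
      ι (n % p)                            ∎

    ι[n∸m]≈0 : ∀ {m n} → m ≤ n → ι m ≈ ι n → ι (n ∸ m) ≈ 0#
    ι[n∸m]≈0 {m} {n} m≤n ιm≈ιn = begin
      ι (n ∸ m)                   ≈⟨ solve 2 (λ a b → b := :- a :+ (a :+ b)) refl (ι m) (ι (n ∸ m)) ⟩
      - ι m + (ι m + ι (n ∸ m))   ≈⟨ +-congˡ (sym (ι-+ m (n ∸ m))) ⟩
      - ι m + ι (m ℕ.+ (n ∸ m))   ≡⟨ ≡.cong (λ k → - ι m + ι k) (ℕP.m+[n∸m]≡n m≤n) ⟩
      - ι m + ι n                 ≈⟨ +-congˡ (sym ιm≈ιn) ⟩
      - ι m + ι m                 ≈⟨ -‿inverseˡ (ι m) ⟩
      0#                          ∎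

    ι≈0⇒≡0 : ∀ {n} → n < p → ι n ≈ 0# → n ≡ 0
    ι≈0⇒≡0 {zero} _ _ = ≡.refl
    ι≈0⇒≡0 {suc n} n<p ιn≈0 = ⊥-elim (ι≉0 (s≤s z≤n) n<p ιn≈0)

    ι-injective-below-p : ∀ {m n} → m < p → n < p → ι m ≈ ι n → m ≡ n
    ι-injective-below-p {m} {n} m<p n<p ιm≈ιn with ℕP.≤-total m n
    ... | inj₁ m≤n = ℕP.≤-antisym m≤n (ℕP.m∸n≡0⇒m≤n
          (ι≈0⇒≡0 (ℕP.≤-<-trans (ℕP.m∸n≤m n m) n<p) (ι[n∸m]≈0 m≤n ιm≈ιn)))
    ... | inj₂ n≤m = ℕP.≤-antisym (ℕP.m∸n≡0⇒m≤n
          (ι≈0⇒≡0 (ℕP.≤-<-trans (ℕP.m∸n≤m m n) m<p) (ι[n∸m]≈0 n≤m (sym ιm≈ιn)))) n≤m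


[1+k]*[1+n]C[1+k]≡[1+n]*nCk : ∀ n k → suc k ℕ.* (suc n C suc k) ≡ suc n ℕ.* (n C k)
[1+k]*[1+n]C[1+k]≡[1+n]*nCk zero zero = ≡.refl
[1+k]*[1+n]C[1+k]≡[1+n]*nCk zero (suc k) = ℕP.*-zeroʳ (suc (suc k))
[1+k]*[1+n]C[1+k]≡[1+n]*nCk (suc n) zero =
  ≡.trans (ℕP.+-identityʳ _) (≡.trans (nC1≡n (suc (suc n))) (≡.sym (ℕP.*-identityʳ (suc (suc n)))))
[1+k]*[1+n]C[1+k]≡[1+n]*nCk (suc n) (suc k) = begin
  suc (suc k) ℕ.* (suc (suc n) C suc (suc k))  ≡⟨ ≡.cong (suc (suc k) ℕ.*_) (≡.sym (nCk+nC[k+1]≡[n+1]C[k+1] (suc n) (suc k))) ⟩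
  suc (suc k) ℕ.* (A ℕ.+ B)                    ≡⟨ solve 3 (λ k A B → (con 2 :+ k) :* (A :+ B) := ((con 1 :+ k) :* A :+ A) :+ (con 2 :+ k) :* B) ≡.refl k A B ⟩
  (suc k ℕ.* A ℕ.+ A) ℕ.+ suc (suc k) ℕ.* B    ≡⟨ ≡.cong₂ (λ u v → (u ℕ.+ A) ℕ.+ v) ([1+k]*[1+n]C[1+k]≡[1+n]*nCk n k) ([1+k]*[1+n]C[1+k]≡[1+n]*nCk n (suc k)) ⟩
  (suc n ℕ.* X ℕ.+ A) ℕ.+ suc n ℕ.* Y          ≡⟨ solve 4 (λ n X A Y → ((con 1 :+ n) :* X :+ A) :+ (con 1 :+ n) :* Y := (con 1 :+ n) :* (X :+ Y) :+ A) ≡.refl n X A Y ⟩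
  suc n ℕ.* (X ℕ.+ Y) ℕ.+ A                    ≡⟨ ≡.cong (λ u → suc n ℕ.* u ℕ.+ A) (nCk+nC[k+1]≡[n+1]C[k+1] n k) ⟩
  suc n ℕ.* A ℕ.+ A                            ≡⟨ ℕP.+-comm (suc n ℕ.* A) A ⟩
  suc (suc n) ℕ.* A                            ∎
  where
  open ≡.≡-Reasoning
  open +-*-Solver using (solve; _:+_; _:*_; _:=_; con)
  A = suc n C suc k
  B = suc n C suc (suc k)
  X = n C k
  Y = n C suc k

p∣pCk : ∀ {p k} → Prime p → 0 < k → k < p → p ∣ p C k
p∣pCk {suc n} {suc j} p-prime _ k<p
  with euclidsLemma (suc j) (suc n C suc j) p-prime
         (≡.subst (suc n ∣_) (≡.sym ([1+k]*[1+n]C[1+k]≡[1+n]*nCk n j)) (m∣m*n (n C j)))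
... | inj₂ p∣pCk = p∣pCk
... | inj₁ p∣k = ⊥-elim (ℕP.<⇒≱ k<p (∣⇒≤ p∣k))

module Frobenius {a ℓ} (S : CommutativeSemiring a ℓ) where

  open CommutativeSemiring S
  open import Relation.Binary.Reasoning.Setoid setoid
  open import Algebra.Properties.CommutativeSemiring.Binomial S using (theorem; binomialTerm)
  open import Algebra.Properties.Semiring.Exp semiring using (_^_)
  open import Algebra.Properties.Semiring.Sum semiring using (sum; sum-init-last; sum-cong-≋; sum-replicate-zero)
  open import Algebra.Properties.Semiring.Mult semiring using (×-assocˡ; ×-congʳ; ×-cong; ×-assoc-*) renaming (_×_ to _×ₙ_)

  ×-zeroʳ : ∀ m → m ×ₙ 0# ≈ 0#
  ×-zeroʳ zero = refl
  ×-zeroʳ (suc m) = trans (+-identityˡ _) (×-zeroʳ m)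

  frobenius : ∀ {p} → Prime p → p ×ₙ 1# ≈ 0# → ∀ x y → (x + y) ^ p ≈ x ^ p + y ^ p
  frobenius {suc n} p-prime p×1≈0 x y = begin
    (x + y) ^ suc n                                                    ≈⟨ theorem (suc n) x y ⟩
    t Fin.zero + sum (λ i → t (Fin.suc i))                             ≈⟨ +-congˡ (sum-init-last (λ i → t (Fin.suc i))) ⟩
    t Fin.zero + (sum (λ i → t (Fin.suc (inject₁ i))) + t (Fin.suc (fromℕ n)))
                                           ≈⟨ +-congˡ (+-congʳ (trans (sum-cong-≋ middle≈0) (sum-replicate-zero n))) ⟩
    t Fin.zero + (0# + t (Fin.suc (fromℕ n)))                         ≈⟨ +-congˡ (+-identityˡ _) ⟩
    t Fin.zero + t (Fin.suc (fromℕ n))                                 ≈⟨ +-comm _ _ ⟩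
    t (Fin.suc (fromℕ n)) + t Fin.zero                                 ≈⟨ +-cong last first ⟩
    x ^ suc n + y ^ suc n                                              ∎
    where
    t = binomialTerm x y (suc n)
    p∣m⇒m×z≈0 : ∀ {m} z → suc n ∣ m → m ×ₙ z ≈ 0#
    p∣m⇒m×z≈0 z (divides d ≡.refl) = begin
      (d ℕ.* suc n) ×ₙ z     ≈⟨ sym (×-assocˡ z d (suc n)) ⟩
      d ×ₙ (suc n ×ₙ z)       ≈⟨ ×-congʳ d (trans (×-congʳ (suc n) (sym (*-identityˡ z))) (sym (×-assoc-* (suc n) 1# z))) ⟩
      d ×ₙ ((suc n ×ₙ 1#) * z) ≈⟨ ×-congʳ d (trans (*-congʳ p×1≈0) (zeroˡ z)) ⟩
      d ×ₙ 0#                ≈⟨ ×-zeroʳ d ⟩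
      0#                    ∎
    middle≈0 : ∀ i → t (Fin.suc (inject₁ i)) ≈ 0#
    middle≈0 i = p∣m⇒m×z≈0 _ (≡.subst (λ k → suc n ∣ (suc n C suc k)) (≡.sym (FinP.toℕ-inject₁ i))
                   (p∣pCk p-prime (s≤s z≤n) (s≤s (FinP.toℕ<n i))))
    last : t (Fin.suc (fromℕ n)) ≈ x ^ suc n
    last = begin
      t (Fin.suc (fromℕ n))                           ≡⟨ ≡.cong (λ k → (suc n C k) ×ₙ ((x ^ k) * (y ^ (suc n ∸ k)))) (≡.cong suc (FinP.toℕ-fromℕ n)) ⟩
      (suc n C suc n) ×ₙ ((x ^ suc n) * (y ^ (n ∸ n))) ≈⟨ ×-cong (nCn≡1 (suc n)) (*-congˡ (reflexive (≡.cong (y ^_) (ℕP.n∸n≡0 n)))) ⟩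
      1 ×ₙ ((x ^ suc n) * 1#)                          ≈⟨ trans (+-identityʳ _) (*-identityʳ _) ⟩
      x ^ suc n                                       ∎
    first : t Fin.zero ≈ y ^ suc n
    first = trans (+-identityʳ _) (*-identityˡ _)


module FiniteField {c ℓ} (F : CommutativeRing c ℓ) (isField : IsField F) {q : ℕ} (card : HasCard F q) where

  open CommutativeRing F

  enum : Fin q → Carrier
  enum = proj₁ card

  enum-injective : ∀ i j → enum i ≈ enum j → i ≡ j
  enum-injective = proj₁ (proj₂ card)

  index : Carrier → Fin q
  index x = proj₁ (proj₂ (proj₂ card) x)

  enum-index : ∀ x → enum (index x) ≈ x
  enum-index x = proj₂ (proj₂ (proj₂ card) x)

  index-cong : ∀ {x y} → x ≈ y → index x ≡ index y
  index-cong {x} {y} x≈y = enum-injective _ _ (trans (enum-index x) (trans x≈y (sym (enum-index y))))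

  index-enum : ∀ i → index (enum i) ≡ i
  index-enum i = enum-injective _ _ (enum-index (enum i))

  index-injective : ∀ {x y} → index x ≡ index y → x ≈ y
  index-injective {x} {y} eq = trans (sym (enum-index x)) (trans (reflexive (≡.cong enum eq)) (enum-index y))

  infix 4 _≟_
  _≟_ : Decidable _≈_
  x ≟ y with index x Fin.≟ index y
  ... | yes eq = yes (index-injective eq)
  ... | no neq = no (neq ∘ index-cong)

  open DecidableField F isField _≟_ public

  module Reindexing {a b} (M : CommutativeMonoid a b) where
    private module M = CommutativeMonoid M
    open import Algebra.Properties.CommutativeMonoid.Sum M using (sum; sum-permute; sum-cong-≋)

    sum-invariant : (φ ψ : Carrier → Carrier)
      → (∀ {x y} → x ≈ y → φ x ≈ φ y) → (∀ {x y} → x ≈ y → ψ x ≈ ψ y)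
      → (∀ x → φ (ψ x) ≈ x) → (∀ x → ψ (φ x) ≈ x)
      → (h : Carrier → M.Carrier) → (∀ {x y} → x ≈ y → h x M.≈ h y)
      → sum (λ i → h (φ (enum i))) M.≈ sum (λ i → h (enum i))
    sum-invariant φ ψ φ-cong ψ-cong φψ ψφ h h-cong = M.sym (M.trans
        (sum-permute (h ∘ enum) π)
        (sum-cong-≋ (λ i → h-cong (enum-index (φ (enum i))))))
      where
      φ̂ ψ̂ : Fin q → Fin q
      φ̂ i = index (φ (enum i))
      ψ̂ i = index (ψ (enum i))
      π : Permutation q q
      π = permutation φ̂ ψ̂
        (λ i → ≡.trans (index-cong (trans (φ-cong (enum-index _)) (φψ (enum i)))) (index-enum i))
        (λ i → ≡.trans (index-cong (trans (ψ-cong (enum-index _)) (ψφ (enum i)))) (index-enum i))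

  -- Translation by 1 permutes F, so the sum of all elements is also the sum of all elements plus q · 1.
  ιq≈0 : ι q ≈ 0#
  ιq≈0 = +-cancelˡ (begin
    total + ι q                        ≈⟨ +-congˡ (sym (sum-of-ones q)) ⟩
    total + sum {q} (λ _ → 1#)         ≈⟨ sym (∑-distrib-+ enum (λ _ → 1#)) ⟩
    sum {q} (λ i → enum i + 1#)        ≈⟨ sum-invariant (_+ 1#) (_- 1#) +-congʳ +-congʳ
                                            (λ x → solve 1 (λ x → x :- con (+ 1) :+ con (+ 1) := x) refl x)
                                            (λ x → solve 1 (λ x → x :+ con (+ 1) :- con (+ 1) := x) refl x)
                                            (λ x → x) (λ x≈y → x≈y) ⟩
    total                              ≈⟨ sym (+-identityʳ total) ⟩
    total + 0#                         ∎)
    where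
    open import Algebra.Properties.CommutativeMonoid.Sum +-commutativeMonoid using (sum; ∑-distrib-+)
    open Reindexing +-commutativeMonoid using (sum-invariant)
    total = sum {q} enum
    sum-of-ones : ∀ n → sum {n} (λ _ → 1#) ≈ ι n
    sum-of-ones zero = refl
    sum-of-ones (suc n) = trans (+-congˡ (sum-of-ones n)) (sym (ι-suc n))
    +-cancelˡ : ∀ {x y} → total + x ≈ total + y → x ≈ y
    +-cancelˡ {x} {y} eq = begin
      x                       ≈⟨ solve 2 (λ a x → x := :- a :+ (a :+ x)) refl total x ⟩
      - total + (total + x)   ≈⟨ +-congˡ eq ⟩
      - total + (total + y)   ≈⟨ solve 2 (λ a y → :- a :+ (a :+ y) := y) refl total y ⟩
      y                       ∎

  ι-^ : ∀ m n → ι (m ℕ.^ n) ≈ ι m ^ n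
  ι-^ m zero = refl
  ι-^ m (suc n) = trans (ι-* m (m ℕ.^ n)) (*-congˡ (ι-^ m n))

  q≡pᵏ⇒ιp≈0 : ∀ {p k} → q ≡ p ℕ.^ k → ι p ≈ 0#
  q≡pᵏ⇒ιp≈0 {p} {k} q≡pᵏ = x^n≈0⇒x≈0 k (trans (sym (ι-^ p k)) (trans (reflexive (≡.cong ι (≡.sym q≡pᵏ))) ιq≈0))

  orOne : Carrier → Carrier
  orOne y with y ≟ 0#
  ... | yes _ = 1#
  ... | no _ = y

  orOne≉0 : ∀ y → ¬ (orOne y ≈ 0#)
  orOne≉0 y with y ≟ 0#
  ... | yes _ = 1≉0
  ... | no y≉0 = y≉0

  orOne-cong : ∀ {y z} → y ≈ z → orOne y ≈ orOne z
  orOne-cong {y} {z} y≈z with y ≟ 0# | z ≟ 0#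
  ... | yes _ | yes _ = refl
  ... | yes y≈0 | no z≉0 = ⊥-elim (z≉0 (trans (sym y≈z) y≈0))
  ... | no y≉0 | yes z≈0 = ⊥-elim (y≉0 (trans y≈z z≈0))
  ... | no _ | no _ = y≈z

  -- y ↦ x y permutes F, so it fixes the product of the nonzero elements (taken over all of F with 0 counted as 1),
  -- while it multiplies each of the q - 1 factors by x.
  fermat : ∀ x → ¬ (x ≈ 0#) → x ^ (q ∸ 1) ≈ 1#
  fermat x x≉0 = sym (*-cancelˡ (∏≉0 q (orOne ∘ enum) (orOne≉0 ∘ enum)) (begin
    Π * 1#                                          ≈⟨ *-identityʳ Π ⟩
    Π                                               ≈⟨ sym (sum-invariant (x *_) (x⁻¹ *_) *-congˡ *-congˡ
                                                         (u*[v*y]≈y (*-recip x x≉0))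
                                                         (u*[v*y]≈y (trans (*-comm _ _) (*-recip x x≉0)))
                                                         orOne orOne-cong) ⟩
    prod (λ i → orOne (x * enum i))                 ≈⟨ sum-cong-≋ (orOne[x*y]≈xIfNonzero*orOne ∘ enum) ⟩
    prod (λ i → xIfNonzero (enum i) * orOne (enum i)) ≈⟨ ∑-distrib-+ (xIfNonzero ∘ enum) (orOne ∘ enum) ⟩
    prod (xIfNonzero ∘ enum) * Π                    ≈⟨ *-comm _ _ ⟩
    Π * prod (xIfNonzero ∘ enum)                    ≈⟨ *-congˡ (∏≈x^[n∸1] q (xIfNonzero ∘ enum) (index 0#) xIfNonzero[0] xIfNonzero[y]) ⟩
    Π * x ^ (q ∸ 1)                                 ∎))
    where
    open import Algebra.Properties.CommutativeMonoid.Sum *-commutativeMonoid using (∑-distrib-+; sum-cong-≋)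
      renaming (sum to prod)
    open Reindexing *-commutativeMonoid using (sum-invariant)

    Π = prod (orOne ∘ enum)
    x⁻¹ = recip x x≉0

    u*[v*y]≈y : ∀ {u v} → u * v ≈ 1# → ∀ y → u * (v * y) ≈ y
    u*[v*y]≈y uv≈1 y = trans (sym (*-assoc _ _ _)) (trans (*-congʳ uv≈1) (*-identityˡ y))

    xIfNonzero : Carrier → Carrier
    xIfNonzero y with y ≟ 0#
    ... | yes _ = 1#
    ... | no _ = x

    orOne[x*y]≈xIfNonzero*orOne : ∀ y → orOne (x * y) ≈ xIfNonzero y * orOne y
    orOne[x*y]≈xIfNonzero*orOne y with y ≟ 0# | (x * y) ≟ 0#
    ... | yes _ | yes _ = sym (*-identityˡ 1#)
    ... | yes y≈0 | no xy≉0 = ⊥-elim (xy≉0 (trans (*-congˡ y≈0) (zeroʳ x)))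
    ... | no y≉0 | yes xy≈0 = ⊥-elim (x*y≉0 x≉0 y≉0 xy≈0)
    ... | no _ | no _ = refl

    xIfNonzero[0] : xIfNonzero (enum (index 0#)) ≈ 1#
    xIfNonzero[0] with enum (index 0#) ≟ 0#
    ... | yes _ = refl
    ... | no e≉0 = ⊥-elim (e≉0 (enum-index 0#))

    xIfNonzero[y] : ∀ j → j ≢ index 0# → xIfNonzero (enum j) ≈ x
    xIfNonzero[y] j j≢0 with enum j ≟ 0#
    ... | yes e≈0 = ⊥-elim (j≢0 (≡.trans (≡.sym (index-enum j)) (index-cong e≈0)))
    ... | no _ = refl

    ∏≈x^n : ∀ n (f : Fin n → Carrier) → (∀ j → f j ≈ x) → prod f ≈ x ^ n
    ∏≈x^n zero f _ = refl
    ∏≈x^n (suc n) f f≈x = *-cong (f≈x Fin.zero) (∏≈x^n n (f ∘ Fin.suc) (f≈x ∘ Fin.suc))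

    ∏≈x^[n∸1] : ∀ n (f : Fin n → Carrier) (i : Fin n) → f i ≈ 1# → (∀ j → j ≢ i → f j ≈ x) → prod f ≈ x ^ (n ∸ 1)
    ∏≈x^[n∸1] (suc n) f Fin.zero fi≈1 f≈x =
      trans (*-cong fi≈1 (∏≈x^n n (f ∘ Fin.suc) (λ j → f≈x (Fin.suc j) (λ ())))) (*-identityˡ _)
    ∏≈x^[n∸1] (suc (suc n)) f (Fin.suc i) fi≈1 f≈x =
      *-cong (f≈x Fin.zero (λ ())) (∏≈x^[n∸1] (suc n) (f ∘ Fin.suc) i fi≈1 (λ j j≢i → f≈x (Fin.suc j) (j≢i ∘ FinP.suc-injective)))

    ∏≉0 : ∀ n (f : Fin n → Carrier) → (∀ j → ¬ (f j ≈ 0#)) → ¬ (prod f ≈ 0#)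
    ∏≉0 zero f _ = 1≉0
    ∏≉0 (suc n) f f≉0 = x*y≉0 (f≉0 Fin.zero) (∏≉0 n (f ∘ Fin.suc) (f≉0 ∘ Fin.suc))


module PolynomialRoots {c ℓ} (F : CommutativeRing c ℓ) (isField : IsField F)
                       (_≟_ : Decidable (CommutativeRing._≈_ F)) where

  open CommutativeRing F
  open DecidableField F isField _≟_

  eval : List Carrier → Carrier → Carrier
  eval [] x = 0#
  eval (a ∷ as) x = a + x * eval as x

  quot : Carrier → List Carrier → List Carrier
  rem : Carrier → List Carrier → Carrier
  quot a [] = []
  quot a (_ ∷ []) = []
  quot a (_ ∷ b ∷ bs) = rem a (b ∷ bs) ∷ quot a (b ∷ bs)
  rem a [] = 0#
  rem a (b ∷ []) = b
  rem a (b ∷ b′ ∷ bs) = b + a * rem a (b′ ∷ bs)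

  division : ∀ a P x → eval P x ≈ (x - a) * eval (quot a P) x + rem a P
  division a [] x = solve 2 (λ x a → con (+ 0) := (x :- a) :* con (+ 0) :+ con (+ 0)) refl x a
  division a (b ∷ []) x = solve 3 (λ x a b → b :+ x :* con (+ 0) := (x :- a) :* con (+ 0) :+ b) refl x a b
  division a (b ∷ b′ ∷ bs) x = begin
    b + x * eval (b′ ∷ bs) x            ≈⟨ +-congˡ (*-congˡ (division a (b′ ∷ bs) x)) ⟩
    b + x * ((x - a) * Q + r)           ≈⟨ solve 5 (λ b x a Q r → b :+ x :* ((x :- a) :* Q :+ r) := (x :- a) :* (r :+ x :* Q) :+ (b :+ a :* r)) refl b x a Q r ⟩
    (x - a) * (r + x * Q) + (b + a * r) ∎
    where
    Q = eval (quot a (b′ ∷ bs)) x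
    r = rem a (b′ ∷ bs)

  rem≈eval : ∀ a P → rem a P ≈ eval P a
  rem≈eval a P = sym (trans (division a P a) (trans (+-congʳ (trans (*-congʳ (-‿inverseʳ a)) (zeroˡ _))) (+-identityˡ _)))

  length-quot : ∀ a P → length (quot a P) ≡ length P ∸ 1
  length-quot a [] = ≡.refl
  length-quot a (_ ∷ []) = ≡.refl
  length-quot a (_ ∷ b ∷ bs) = ≡.cong suc (length-quot a (b ∷ bs))

  quot≈0∧rem≈0⇒≈0 : ∀ a P → All (_≈ 0#) (quot a P) → rem a P ≈ 0# → All (_≈ 0#) P
  quot≈0∧rem≈0⇒≈0 a [] _ _ = []
  quot≈0∧rem≈0⇒≈0 a (b ∷ []) _ b≈0 = b≈0 ∷ []
  quot≈0∧rem≈0⇒≈0 a (b ∷ b′ ∷ bs) (r′≈0 ∷ Q≈0) r≈0 =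
    trans (sym (trans (+-congˡ (trans (*-congˡ r′≈0) (zeroʳ a))) (+-identityʳ b))) r≈0
      ∷ quot≈0∧rem≈0⇒≈0 a (b′ ∷ bs) Q≈0 r′≈0

  roots≤length : ∀ n (x : Fin n → Carrier) → (∀ i j → x i ≈ x j → i ≡ j)
    → ∀ P → length P ≤ n → (∀ i → eval P (x i) ≈ 0#) → All (_≈ 0#) P
  roots≤length zero x _ [] _ _ = []
  roots≤length (suc n) x x-injective P length≤n P[x]≈0 =
    quot≈0∧rem≈0⇒≈0 a P (roots≤length n (x ∘ Fin.suc) x′-injective (quot a P) length≤n′ Q[x′]≈0) r≈0
    where
    a = x Fin.zero
    x′-injective : ∀ i j → x (Fin.suc i) ≈ x (Fin.suc j) → i ≡ j
    x′-injective i j eq = FinP.suc-injective (x-injective _ _ eq)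
    length≤n′ : length (quot a P) ≤ n
    length≤n′ = ≡.subst (_≤ n) (≡.sym (length-quot a P)) (ℕP.∸-monoˡ-≤ 1 length≤n)
    r≈0 : rem a P ≈ 0#
    r≈0 = trans (rem≈eval a P) (P[x]≈0 Fin.zero)
    Q[x′]≈0 : ∀ i → eval (quot a P) (x (Fin.suc i)) ≈ 0#
    Q[x′]≈0 i with x*y≈0⇒x≈0⊎y≈0 {x (Fin.suc i) - a} {eval (quot a P) (x (Fin.suc i))}
                (trans (sym (+-identityʳ _)) (trans (+-congˡ (sym r≈0)) (trans (sym (division a P (x (Fin.suc i)))) (P[x]≈0 (Fin.suc i)))))
    ... | inj₂ Q≈0 = Q≈0
    ... | inj₁ x≈a with x-injective (Fin.suc i) Fin.zero (x∙y⁻¹≈ε⇒x≈y _ _ x≈a)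
    ...   | ()

  Xⁿ : ℕ → List Carrier
  Xⁿ zero = 1# ∷ []
  Xⁿ (suc n) = 0# ∷ Xⁿ n

  length-Xⁿ : ∀ n → length (Xⁿ n) ≡ suc n
  length-Xⁿ zero = ≡.refl
  length-Xⁿ (suc n) = ≡.cong suc (length-Xⁿ n)

  eval-Xⁿ : ∀ n x → eval (Xⁿ n) x ≈ x ^ n
  eval-Xⁿ zero x = trans (+-congˡ (zeroʳ x)) (+-identityʳ 1#)
  eval-Xⁿ (suc n) x = trans (+-identityˡ _) (*-congˡ (eval-Xⁿ n x))


2+r*4≡[1+r*2]*2 : ∀ r → 2 ℕ.+ r ℕ.* 4 ≡ 2 ℕ.* (1 ℕ.+ r ℕ.* 2)
2+r*4≡[1+r*2]*2 = solve 1 (λ r → con 2 :+ r :* con 4 := con 2 :* (con 1 :+ r :* con 2)) ≡.refl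
  where open +-*-Solver using (solve; _:+_; _:*_; _:=_; con)

[1+r]*4≡m+m : ∀ r → suc r ℕ.* 4 ≡ (suc r ℕ.+ suc r) ℕ.+ (suc r ℕ.+ suc r)
[1+r]*4≡m+m = solve 1 (λ r → (con 1 :+ r) :* con 4 := ((con 1 :+ r) :+ (con 1 :+ r)) :+ ((con 1 :+ r) :+ (con 1 :+ r))) ≡.refl
  where open +-*-Solver using (solve; _:+_; _:*_; _:=_; con)

3+[r+[1+r]]≤1+[1+r]*4 : ∀ r → 3 ℕ.+ (r ℕ.+ suc r) ≤ 1 ℕ.+ suc r ℕ.* 4
3+[r+[1+r]]≤1+[1+r]*4 r = ≡.subst (3 ℕ.+ (r ℕ.+ suc r) ≤_) (eq r) (ℕP.m≤m+n _ (1 ℕ.+ r ℕ.* 2))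
  where
  open +-*-Solver using (solve; _:+_; _:*_; _:=_; con)
  eq : ∀ r → (3 ℕ.+ (r ℕ.+ suc r)) ℕ.+ (1 ℕ.+ r ℕ.* 2) ≡ 1 ℕ.+ suc r ℕ.* 4
  eq = solve 1 (λ r → (con 3 :+ (r :+ (con 1 :+ r))) :+ (con 1 :+ r :* con 2) := con 1 :+ (con 1 :+ r) :* con 4) ≡.refl

module SquareRootsOfMinusOne {c ℓ} (F : CommutativeRing c ℓ) (isField : IsField F) {q : ℕ} (card : HasCard F q) where

  open CommutativeRing F
  open FiniteField F isField card
  open PolynomialRoots F isField _≟_

  2≤q : 2 ≤ q
  2≤q = FinP.injective⇒≤ {f = two-elements} two-elements-injective
    where
    two-elements : Fin 2 → Fin q
    two-elements Fin.zero = index 0#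
    two-elements (Fin.suc _) = index 1#
    0≉1 : ¬ (index 0# ≡ index 1#)
    0≉1 eq = 1≉0 (sym (index-injective eq))
    two-elements-injective : ∀ {i j} → two-elements i ≡ two-elements j → i ≡ j
    two-elements-injective {Fin.zero} {Fin.zero} _ = ≡.refl
    two-elements-injective {Fin.zero} {Fin.suc Fin.zero} eq = ⊥-elim (0≉1 eq)
    two-elements-injective {Fin.suc Fin.zero} {Fin.zero} eq = ⊥-elim (0≉1 (≡.sym eq))
    two-elements-injective {Fin.suc Fin.zero} {Fin.suc Fin.zero} _ = ≡.refl

  q≡s+r*4 : ∀ {s} → q % 4 ≡ s → q ≡ s ℕ.+ (q / 4) ℕ.* 4
  q≡s+r*4 q%4≡s = ≡.trans (m≡m%n+[m/n]*n q 4) (≡.cong (ℕ._+ (q / 4) ℕ.* 4) q%4≡s)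

  -1^[1+n*2]≈-1 : ∀ n → (- 1#) ^ (1 ℕ.+ n ℕ.* 2) ≈ - 1#
  -1^[1+n*2]≈-1 zero = *-identityʳ (- 1#)
  -1^[1+n*2]≈-1 (suc n) = trans (solve 1 (λ x → :- con (+ 1) :* (:- con (+ 1) :* x) := x) refl _) (-1^[1+n*2]≈-1 n)

  q≡3[4]⇒1+1≉0 : q % 4 ≡ 3 → ¬ (1# + 1# ≈ 0#)
  q≡3[4]⇒1+1≉0 q%4≡3 1+1≈0 = 1≉0 (sym (begin
    0#                                      ≈⟨ sym ιq≈0 ⟩
    ι q                                     ≡⟨ ≡.cong ι (q≡s+r*4 q%4≡3) ⟩
    ι (3 ℕ.+ r ℕ.* 4)                       ≈⟨ trans (ι-+ 3 (r ℕ.* 4)) (+-congˡ (ι-* r 4)) ⟩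
    ((1# + 1#) + 1#) + ι r * (((1# + 1#) + 1#) + 1#)
                                            ≈⟨ +-cong (+-congʳ 1+1≈0) (*-congˡ (+-congʳ (+-congʳ 1+1≈0))) ⟩
    (0# + 1#) + ι r * ((0# + 1#) + 1#)      ≈⟨ solve 1 (λ r → (con (+ 0) :+ con (+ 1)) :+ r :* ((con (+ 0) :+ con (+ 1)) :+ con (+ 1))
                                                         := con (+ 1) :+ r :* (con (+ 1) :+ con (+ 1))) refl (ι r) ⟩
    1# + ι r * (1# + 1#)                    ≈⟨ +-congˡ (trans (*-congˡ 1+1≈0) (zeroʳ (ι r))) ⟩
    1# + 0#                                 ≈⟨ +-identityʳ 1# ⟩
    1#                                      ∎))
    where r = q / 4

  q≡3[4]⇒i²≉-1 : q % 4 ≡ 3 → ∀ i → ¬ (i * i ≈ - 1#)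
  q≡3[4]⇒i²≉-1 q%4≡3 i i²≈-1 = q≡3[4]⇒1+1≉0 q%4≡3 (begin
    1# + 1#                          ≈⟨ +-congˡ (sym (fermat i i≉0)) ⟩
    1# + i ^ (q ∸ 1)                 ≡⟨ ≡.cong (λ n → 1# + i ^ (n ∸ 1)) (q≡s+r*4 q%4≡3) ⟩
    1# + i ^ (2 ℕ.+ r ℕ.* 4)         ≡⟨ ≡.cong (λ n → 1# + i ^ n) (2+r*4≡[1+r*2]*2 r) ⟩
    1# + i ^ (2 ℕ.* (1 ℕ.+ r ℕ.* 2)) ≈⟨ +-congˡ (sym (^-assocʳ i 2 (1 ℕ.+ r ℕ.* 2))) ⟩
    1# + (i ^ 2) ^ (1 ℕ.+ r ℕ.* 2)   ≈⟨ +-congˡ (^-congˡ (1 ℕ.+ r ℕ.* 2) (trans (*-congˡ (*-identityʳ i)) i²≈-1)) ⟩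
    1# + (- 1#) ^ (1 ℕ.+ r ℕ.* 2)    ≈⟨ +-congˡ (-1^[1+n*2]≈-1 r) ⟩
    1# - 1#                          ≈⟨ -‿inverseʳ 1# ⟩
    0#                               ∎)
    where
    r = q / 4
    i≉0 : ¬ (i ≈ 0#)
    i≉0 i≈0 = 1≉0 (begin
      1#          ≈⟨ sym (-‿involutive 1#) ⟩
      - - 1#      ≈⟨ -‿cong (sym i²≈-1) ⟩
      - (i * i)   ≈⟨ -‿cong (trans (*-congʳ i≈0) (zeroˡ i)) ⟩
      - 0#        ≈⟨ -0#≈0# ⟩
      0#          ∎)

  module _ (m : ℕ) (m+3≤q : 3 ℕ.+ m ≤ q) where

    private
      X^[2+m]-X : List Carrier
      X^[2+m]-X = 0# ∷ - 1# ∷ Xⁿ m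

      x : Fin (3 ℕ.+ m) → Carrier
      x i = enum (Fin.inject≤ i m+3≤q)

      x-injective : ∀ i j → x i ≈ x j → i ≡ j
      x-injective i j xi≈xj = FinP.inject≤-injective m+3≤q m+3≤q i j (enum-injective _ _ xi≈xj)

      eval-X^[2+m]-X : ∀ y → eval X^[2+m]-X y ≈ y ^ (2 ℕ.+ m) - y
      eval-X^[2+m]-X y = begin
        0# + y * (- 1# + y * eval (Xⁿ m) y)  ≈⟨ +-congˡ (*-congˡ (+-congˡ (*-congˡ (eval-Xⁿ m y)))) ⟩
        0# + y * (- 1# + y * y ^ m)          ≈⟨ solve 2 (λ y z → con (+ 0) :+ y :* (:- con (+ 1) :+ y :* z) := y :* (y :* z) :- y) refl y (y ^ m) ⟩
        y ^ (2 ℕ.+ m) - y                    ∎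

    -- X^(m+2) - X has at most m + 2 roots, so some element of the field is not one of them.
    ∃y^[2+m]≉y : ∃ λ y → ¬ (y ^ (2 ℕ.+ m) ≈ y)
    ∃y^[2+m]≉y = case (FinP.all? (λ i → (enum i ^ (2 ℕ.+ m)) ≟ enum i))
      where
      -1≈0 : All (_≈ 0#) X^[2+m]-X → - 1# ≈ 0#
      -1≈0 (_ ∷ -1≈0 ∷ _) = -1≈0
      case : Dec (∀ i → enum i ^ (2 ℕ.+ m) ≈ enum i) → ∃ λ y → ¬ (y ^ (2 ℕ.+ m) ≈ y)
      case (no ¬∀) = let (i , ¬root) = FinP.¬∀⟶∃¬ q _ (λ i → (enum i ^ (2 ℕ.+ m)) ≟ enum i) ¬∀ in enum i , ¬root
      case (yes ∀root) = ⊥-elim (1≉0 (trans (sym (-‿involutive 1#)) (trans (-‿cong (-1≈0 X^[2+m]-X≈0)) -0#≈0#)))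
        where
        X^[2+m]-X≈0 : All (_≈ 0#) X^[2+m]-X
        X^[2+m]-X≈0 = roots≤length (3 ℕ.+ m) x x-injective X^[2+m]-X (ℕP.≤-reflexive (≡.cong (2 ℕ.+_) (length-Xⁿ m)))
                        (λ i → trans (eval-X^[2+m]-X (x i)) (x≈y⇒x∙y⁻¹≈ε (∀root _)))

  -- With m = (q - 1)/2, pick y that is not a root of X^(m+1) - X. Then y^m ≠ 1 while (y^m)² = y^(q-1) = 1, so
  -- y^m = -1, and m is even.
  q≡1[4]⇒∃i²≈-1 : q % 4 ≡ 1 → ∃ λ i → i * i ≈ - 1#
  q≡1[4]⇒∃i²≈-1 q%4≡1 with q / 4 | q≡s+r*4 q%4≡1
  ... | zero | q≡1 = ⊥-elim (ℕP.<⇒≱ (≡.subst (_< 2) (≡.sym q≡1) ℕP.≤-refl) 2≤q)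
  ... | suc r | q≡1+[1+r]*4 = y ^ suc r , y^[1+r]²≈-1 (x*x≈y*y⇒x≈y⊎x≈-y (trans y^m*y^m≈1 (sym (*-identityˡ 1#))))
    where
    m = suc r ℕ.+ suc r
    nonRoot : ∃ λ y → ¬ (y ^ suc m ≈ y)
    nonRoot = ∃y^[2+m]≉y (r ℕ.+ suc r) (≡.subst (3 ℕ.+ (r ℕ.+ suc r) ≤_) (≡.sym q≡1+[1+r]*4) (3+[r+[1+r]]≤1+[1+r]*4 r))
    y = proj₁ nonRoot
    y^[1+m]≉y = proj₂ nonRoot
    y≉0 : ¬ (y ≈ 0#)
    y≉0 y≈0 = y^[1+m]≉y (trans (*-congʳ y≈0) (trans (zeroˡ _) (sym y≈0)))
    y^m*y^m≈1 : y ^ m * y ^ m ≈ 1#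
    y^m*y^m≈1 = begin
      y ^ m * y ^ m      ≈⟨ sym (^-homo-* y m m) ⟩
      y ^ (m ℕ.+ m)      ≡⟨ ≡.cong (y ^_) (≡.trans (≡.sym ([1+r]*4≡m+m r)) (≡.cong (_∸ 1) (≡.sym q≡1+[1+r]*4))) ⟩
      y ^ (q ∸ 1)        ≈⟨ fermat y y≉0 ⟩
      1#                 ∎
    y^[1+r]²≈-1 : y ^ m ≈ 1# ⊎ y ^ m ≈ - 1# → y ^ suc r * y ^ suc r ≈ - 1#
    y^[1+r]²≈-1 (inj₁ y^m≈1) = ⊥-elim (y^[1+m]≉y (trans (*-congˡ y^m≈1) (*-identityʳ y)))
    y^[1+r]²≈-1 (inj₂ y^m≈-1) = trans (sym (^-homo-* y (suc r) (suc r))) y^m≈-1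


module Matrices {c ℓ} (F : CommutativeRing c ℓ) where

  open CommutativeRing F
  open PSL2 F
  open IntegerCoefficients F
  open import Algebra.Properties.Ring ring using (-‿involutive; -0#≈0#)

  infix 4 _≈M_
  _≈M_ : Mat → Mat → Set ℓ
  g ≈M h = m₁₁ g ≈ m₁₁ h × m₁₂ g ≈ m₁₂ h × m₂₁ g ≈ m₂₁ h × m₂₂ g ≈ m₂₂ h

  ≈M-refl : ∀ {g} → g ≈M g
  ≈M-refl = refl , refl , refl , refl

  ≈M-sym : ∀ {g h} → g ≈M h → h ≈M g
  ≈M-sym (e₁₁ , e₁₂ , e₂₁ , e₂₂) = sym e₁₁ , sym e₁₂ , sym e₂₁ , sym e₂₂

  ≈M-trans : ∀ {g h k} → g ≈M h → h ≈M k → g ≈M k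
  ≈M-trans (e₁₁ , e₁₂ , e₂₁ , e₂₂) (f₁₁ , f₁₂ , f₂₁ , f₂₂) = trans e₁₁ f₁₁ , trans e₁₂ f₁₂ , trans e₂₁ f₂₁ , trans e₂₂ f₂₂

  neg : Mat → Mat
  neg g = mat (- m₁₁ g) (- m₁₂ g) (- m₂₁ g) (- m₂₂ g)

  neg-involutive : ∀ g → neg (neg g) ≈M g
  neg-involutive g = -‿involutive _ , -‿involutive _ , -‿involutive _ , -‿involutive _

  neg-cong : ∀ {g h} → g ≈M h → neg g ≈M neg h
  neg-cong (e₁₁ , e₁₂ , e₂₁ , e₂₂) = -‿cong e₁₁ , -‿cong e₁₂ , -‿cong e₂₁ , -‿cong e₂₂

  ≈P-refl : ∀ {g} → g ≈P g
  ≈P-refl = inj₁ ≈M-refl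

  ≈P-sym : ∀ {g h} → g ≈P h → h ≈P g
  ≈P-sym (inj₁ g≈h) = inj₁ (≈M-sym g≈h)
  ≈P-sym {g} {h} (inj₂ g≈-h) = inj₂ (≈M-trans (≈M-sym (neg-involutive h)) (neg-cong (≈M-sym g≈-h)))

  ≈P-trans : ∀ {g h k} → g ≈P h → h ≈P k → g ≈P k
  ≈P-trans (inj₁ g≈h) (inj₁ h≈k) = inj₁ (≈M-trans g≈h h≈k)
  ≈P-trans (inj₁ g≈h) (inj₂ h≈-k) = inj₂ (≈M-trans g≈h h≈-k)
  ≈P-trans (inj₂ g≈-h) (inj₁ h≈k) = inj₂ (≈M-trans g≈-h (neg-cong h≈k))
  ≈P-trans {k = k} (inj₂ g≈-h) (inj₂ h≈-k) = inj₁ (≈M-trans g≈-h (≈M-trans (neg-cong h≈-k) (neg-involutive k)))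

  ≈M⇒≈P : ∀ {g h} → g ≈M h → g ≈P h
  ≈M⇒≈P = inj₁

  ≈P-I⇒m₁₂≈0 : ∀ {g} → g ≈P I → m₁₂ g ≈ 0#
  ≈P-I⇒m₁₂≈0 (inj₁ (_ , e , _ , _)) = e
  ≈P-I⇒m₁₂≈0 (inj₂ (_ , e , _ , _)) = trans e -0#≈0#

  ≈P-I⇒m₂₁≈0 : ∀ {g} → g ≈P I → m₂₁ g ≈ 0#
  ≈P-I⇒m₂₁≈0 (inj₁ (_ , _ , e , _)) = e
  ≈P-I⇒m₂₁≈0 (inj₂ (_ , _ , e , _)) = trans e -0#≈0#

  ≈P-I⇒m₁₁≈m₂₂ : ∀ {g} → g ≈P I → m₁₁ g ≈ m₂₂ g
  ≈P-I⇒m₁₁≈m₂₂ (inj₁ (e₁₁ , _ , _ , e₂₂)) = trans e₁₁ (sym e₂₂)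
  ≈P-I⇒m₁₁≈m₂₂ (inj₂ (e₁₁ , _ , _ , e₂₂)) = trans e₁₁ (sym e₂₂)

  scalar : Carrier → Mat
  scalar x = mat x 0# 0# x

  scalar-±1≈P-I : ∀ {ε} → ε ≈ 1# ⊎ ε ≈ - 1# → scalar ε ≈P I
  scalar-±1≈P-I (inj₁ ε≈1) = inj₁ (ε≈1 , refl , refl , ε≈1)
  scalar-±1≈P-I (inj₂ ε≈-1) = inj₂ (ε≈-1 , sym -0#≈0# , sym -0#≈0# , ε≈-1)

  ·-cong : ∀ {g g′ h h′} → g ≈M g′ → h ≈M h′ → g · h ≈M g′ · h′
  ·-cong (a , b , c , d) (a′ , b′ , c′ , d′) =
    +-cong (*-cong a a′) (*-cong b c′) , +-cong (*-cong a b′) (*-cong b d′) ,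
    +-cong (*-cong c a′) (*-cong d c′) , +-cong (*-cong c b′) (*-cong d d′)

  ^ᴹ-cong : ∀ {g h} n → g ≈M h → g ^ᴹ n ≈M h ^ᴹ n
  ^ᴹ-cong zero _ = ≈M-refl
  ^ᴹ-cong (suc n) g≈h = ·-cong g≈h (^ᴹ-cong n g≈h)

  inv-cong : ∀ {g h} → g ≈M h → inv g ≈M inv h
  inv-cong (a , b , c , d) = d , -‿cong b , -‿cong c , a

  tr : Mat → Carrier
  tr g = m₁₁ g + m₂₂ g

  tr-cong : ∀ {g h} → g ≈M h → tr g ≈ tr h
  tr-cong (a , _ , _ , d) = +-cong a d

  tr-neg : ∀ g → tr (neg g) ≈ - tr g
  tr-neg g = solve 2 (λ a d → :- a :+ :- d := :- (a :+ d)) refl (m₁₁ g) (m₂₂ g)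

  det-cong : ∀ {g h} → g ≈M h → det g ≈ det h
  det-cong (a , b , c , d) = +-cong (*-cong a d) (-‿cong (*-cong b c))

  det-· : ∀ g h → det (g · h) ≈ det g * det h
  det-· g h = solve 8 (λ a b c d e f g h → (a :* e :+ b :* g) :* (c :* f :+ d :* h) :- (a :* f :+ b :* h) :* (c :* e :+ d :* g)
                                         := (a :* d :- b :* c) :* (e :* h :- f :* g)) refl
    (m₁₁ g) (m₁₂ g) (m₂₁ g) (m₂₂ g) (m₁₁ h) (m₁₂ h) (m₂₁ h) (m₂₂ h)

  det-inv : ∀ g → det (inv g) ≈ det g
  det-inv g = solve 4 (λ a b c d → d :* a :- (:- b) :* (:- c) := a :* d :- b :* c) refl (m₁₁ g) (m₁₂ g) (m₂₁ g) (m₂₂ g)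

  det-neg : ∀ g → det (neg g) ≈ det g
  det-neg g = solve 4 (λ a b c d → (:- a) :* (:- d) :- (:- b) :* (:- c) := a :* d :- b :* c) refl (m₁₁ g) (m₁₂ g) (m₂₁ g) (m₂₂ g)

  InSL-resp-≈P : ∀ {g h} → g ≈P h → InSL h → InSL g
  InSL-resp-≈P (inj₁ g≈h) h∈SL = trans (det-cong g≈h) h∈SL
  InSL-resp-≈P {h = h} (inj₂ g≈-h) h∈SL = trans (det-cong g≈-h) (trans (det-neg h) h∈SL)

  InSL-· : ∀ {g h} → InSL g → InSL h → InSL (g · h)
  InSL-· {g} {h} g∈SL h∈SL = trans (det-· g h) (trans (*-cong g∈SL h∈SL) (*-identityˡ 1#))

  InSL-^ᴹ : ∀ {g} n → InSL g → InSL (g ^ᴹ n)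
  InSL-^ᴹ zero _ = solve 0 (con (+ 1) :* con (+ 1) :- con (+ 0) :* con (+ 0) := con (+ 1)) refl
  InSL-^ᴹ (suc n) g∈SL = InSL-· g∈SL (InSL-^ᴹ n g∈SL)

  InSL-quotient : ∀ g h → InSL g → InSL h → InSL (h · inv g)
  InSL-quotient g h g∈SL h∈SL = InSL-· h∈SL (trans (det-inv g) g∈SL)

  inv-· : ∀ g → InSL g → inv g · g ≈M I
  inv-· g g∈SL =
      trans (solve 4 (λ a b c d → d :* a :+ (:- b) :* c := a :* d :- b :* c) refl (m₁₁ g) (m₁₂ g) (m₂₁ g) (m₂₂ g)) g∈SL
    , solve 2 (λ b d → d :* b :+ (:- b) :* d := con (+ 0)) refl (m₁₂ g) (m₂₂ g)
    , solve 2 (λ a c → (:- c) :* a :+ a :* c := con (+ 0)) refl (m₁₁ g) (m₂₁ g)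
    , trans (solve 4 (λ a b c d → (:- c) :* b :+ a :* d := a :* d :- b :* c) refl (m₁₁ g) (m₁₂ g) (m₂₁ g) (m₂₂ g)) g∈SL

  ·-assoc : ∀ g h k → (g · h) · k ≈M g · (h · k)
  ·-assoc g h k = entry (m₁₁ g) (m₁₂ g) (m₁₁ k) (m₂₁ k) , entry (m₁₁ g) (m₁₂ g) (m₁₂ k) (m₂₂ k)
                , entry (m₂₁ g) (m₂₂ g) (m₁₁ k) (m₂₁ k) , entry (m₂₁ g) (m₂₂ g) (m₁₂ k) (m₂₂ k)
    where
    entry : ∀ x₁ x₂ y₁ y₂ → (x₁ * m₁₁ h + x₂ * m₂₁ h) * y₁ + (x₁ * m₁₂ h + x₂ * m₂₂ h) * y₂
                          ≈ x₁ * (m₁₁ h * y₁ + m₁₂ h * y₂) + x₂ * (m₂₁ h * y₁ + m₂₂ h * y₂)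
    entry = solve 8 (λ e f g h x₁ x₂ y₁ y₂ → (x₁ :* e :+ x₂ :* g) :* y₁ :+ (x₁ :* f :+ x₂ :* h) :* y₂
                                          := x₁ :* (e :* y₁ :+ f :* y₂) :+ x₂ :* (g :* y₁ :+ h :* y₂)) refl
              (m₁₁ h) (m₁₂ h) (m₂₁ h) (m₂₂ h)

  ·-identityˡ : ∀ g → I · g ≈M g
  ·-identityˡ g = entry (m₁₁ g) (m₂₁ g) , entry (m₁₂ g) (m₂₂ g) , entry′ (m₁₁ g) (m₂₁ g) , entry′ (m₁₂ g) (m₂₂ g)
    where
    entry : ∀ x y → 1# * x + 0# * y ≈ x
    entry = solve 2 (λ x y → con (+ 1) :* x :+ con (+ 0) :* y := x) refl
    entry′ : ∀ x y → 0# * x + 1# * y ≈ y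
    entry′ = solve 2 (λ x y → con (+ 0) :* x :+ con (+ 1) :* y := y) refl

  ·-identityʳ : ∀ g → g · I ≈M g
  ·-identityʳ g = entry (m₁₁ g) (m₁₂ g) , entry′ (m₁₁ g) (m₁₂ g) , entry (m₂₁ g) (m₂₂ g) , entry′ (m₂₁ g) (m₂₂ g)
    where
    entry : ∀ x y → x * 1# + y * 0# ≈ x
    entry = solve 2 (λ x y → x :* con (+ 1) :+ y :* con (+ 0) := x) refl
    entry′ : ∀ x y → x * 0# + y * 1# ≈ y
    entry′ = solve 2 (λ x y → x :* con (+ 0) :+ y :* con (+ 1) := y) refl

  neg-·ˡ : ∀ g h → neg g · h ≈M neg (g · h)
  neg-·ˡ g h = entry (m₁₁ g) (m₁₂ g) (m₁₁ h) (m₂₁ h) , entry (m₁₁ g) (m₁₂ g) (m₁₂ h) (m₂₂ h)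
             , entry (m₂₁ g) (m₂₂ g) (m₁₁ h) (m₂₁ h) , entry (m₂₁ g) (m₂₂ g) (m₁₂ h) (m₂₂ h)
    where
    entry : ∀ a b x y → (- a) * x + (- b) * y ≈ - (a * x + b * y)
    entry = solve 4 (λ a b x y → (:- a) :* x :+ (:- b) :* y := :- (a :* x :+ b :* y)) refl

  neg-·ʳ : ∀ g h → g · neg h ≈M neg (g · h)
  neg-·ʳ g h = entry (m₁₁ g) (m₁₂ g) (m₁₁ h) (m₂₁ h) , entry (m₁₁ g) (m₁₂ g) (m₁₂ h) (m₂₂ h)
             , entry (m₂₁ g) (m₂₂ g) (m₁₁ h) (m₂₁ h) , entry (m₂₁ g) (m₂₂ g) (m₁₂ h) (m₂₂ h)
    where
    entry : ∀ a b x y → a * (- x) + b * (- y) ≈ - (a * x + b * y)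
    entry = solve 4 (λ a b x y → a :* (:- x) :+ b :* (:- y) := :- (a :* x :+ b :* y)) refl

  quotient≈P-I⇒≈P : ∀ g h → InSL g → (h · inv g) ≈P I → h ≈P g
  quotient≈P-I⇒≈P g h g∈SL hg⁻¹≈±I = ≈P-trans (≈M⇒≈P h≈hg⁻¹g) (·g hg⁻¹≈±I)
    where
    h≈hg⁻¹g : h ≈M (h · inv g) · g
    h≈hg⁻¹g = ≈M-sym (≈M-trans (·-assoc h (inv g) g) (≈M-trans (·-cong ≈M-refl (inv-· g g∈SL)) (·-identityʳ h)))
    ·g : (h · inv g) ≈P I → ((h · inv g) · g) ≈P g
    ·g (inj₁ hg⁻¹≈I) = inj₁ (≈M-trans (·-cong hg⁻¹≈I ≈M-refl) (·-identityˡ g))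
    ·g (inj₂ hg⁻¹≈-I) = inj₂ (≈M-trans (·-cong hg⁻¹≈-I ≈M-refl) (≈M-trans (neg-·ˡ I g) (neg-cong (·-identityˡ g))))

  quotient-resp-≈P : ∀ {g g′ h h′} → g ≈P g′ → h ≈P h′ → (h · inv g) ≈P (h′ · inv g′)
  quotient-resp-≈P {g′ = g′} {h′ = h′} (inj₁ g≈g′) (inj₁ h≈h′) = inj₁ (·-cong h≈h′ (inv-cong g≈g′))
  quotient-resp-≈P {g′ = g′} {h′ = h′} (inj₁ g≈g′) (inj₂ h≈-h′) =
    inj₂ (≈M-trans (·-cong h≈-h′ (inv-cong g≈g′)) (neg-·ˡ h′ (inv g′)))
  quotient-resp-≈P {g′ = g′} {h′ = h′} (inj₂ g≈-g′) (inj₁ h≈h′) =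
    inj₂ (≈M-trans (·-cong h≈h′ (inv-cong g≈-g′)) (neg-·ʳ h′ (inv g′)))
  quotient-resp-≈P {g′ = g′} {h′ = h′} (inj₂ g≈-g′) (inj₂ h≈-h′) =
    inj₁ (≈M-trans (·-cong h≈-h′ (inv-cong g≈-g′))
           (≈M-trans (neg-·ˡ h′ (neg (inv g′))) (≈M-trans (neg-cong (neg-·ʳ h′ (inv g′))) (neg-involutive (h′ · inv g′)))))


module QuadraticExtension {c ℓ} (F : CommutativeRing c ℓ) (δ : CommutativeRing.Carrier F) where

  open CommutativeRing F
  open IntegerCoefficients F

  -- ⟨ a , b ⟩ stands for a + b X in F[X]/(X² - δ).
  record Elem : Set c where
    constructor ⟨_,_⟩
    field
      re im : Carrier
  open Elem public

  infix 4 _≋_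
  _≋_ : Elem → Elem → Set ℓ
  u ≋ v = re u ≈ re v × im u ≈ im v

  _⊕_ _⊗_ : Elem → Elem → Elem
  u ⊕ v = ⟨ re u + re v , im u + im v ⟩
  u ⊗ v = ⟨ re u * re v + δ * (im u * im v) , re u * im v + im u * re v ⟩

  F[√δ] : CommutativeSemiring c ℓ
  F[√δ] = record
    { Carrier = Elem ; _≈_ = _≋_ ; _+_ = _⊕_ ; _*_ = _⊗_ ; 0# = ⟨ 0# , 0# ⟩ ; 1# = ⟨ 1# , 0# ⟩
    ; isCommutativeSemiring = record
      { isSemiring = record
        { isSemiringWithoutAnnihilatingZero = record
          { +-isCommutativeMonoid = record
            { isMonoid = record
              { isSemigroup = record
                { isMagma = record
                  { isEquivalence = record
                    { refl = refl , refl
                    ; sym = λ (e₁ , e₂) → sym e₁ , sym e₂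
                    ; trans = λ (e₁ , e₂) (f₁ , f₂) → trans e₁ f₁ , trans e₂ f₂ }
                  ; ∙-cong = λ (e₁ , e₂) (f₁ , f₂) → +-cong e₁ f₁ , +-cong e₂ f₂ }
                ; assoc = λ _ _ _ → +-assoc _ _ _ , +-assoc _ _ _ }
              ; identity = (λ _ → +-identityˡ _ , +-identityˡ _) , (λ _ → +-identityʳ _ , +-identityʳ _) }
            ; comm = λ _ _ → +-comm _ _ , +-comm _ _ }
          ; *-cong = λ (e₁ , e₂) (f₁ , f₂) → +-cong (*-cong e₁ f₁) (*-congˡ (*-cong e₂ f₂)) , +-cong (*-cong e₁ f₂) (*-cong e₂ f₁)
          ; *-assoc = λ u v w →
              solve 7 (λ δ a b c d e f → (a :* c :+ δ :* (b :* d)) :* e :+ δ :* ((a :* d :+ b :* c) :* f)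
                                       := a :* (c :* e :+ δ :* (d :* f)) :+ δ :* (b :* (c :* f :+ d :* e))) refl
                δ (re u) (im u) (re v) (im v) (re w) (im w)
            , solve 7 (λ δ a b c d e f → (a :* c :+ δ :* (b :* d)) :* f :+ (a :* d :+ b :* c) :* e
                                       := a :* (c :* f :+ d :* e) :+ b :* (c :* e :+ δ :* (d :* f))) refl
                δ (re u) (im u) (re v) (im v) (re w) (im w)
          ; *-identity = (λ u → solve 3 (λ δ a b → con (+ 1) :* a :+ δ :* (con (+ 0) :* b) := a) refl δ (re u) (im u)
                              , solve 2 (λ a b → con (+ 1) :* b :+ con (+ 0) :* a := b) refl (re u) (im u))
                       , (λ u → solve 3 (λ δ a b → a :* con (+ 1) :+ δ :* (b :* con (+ 0)) := a) refl δ (re u) (im u)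
                              , solve 2 (λ a b → a :* con (+ 0) :+ b :* con (+ 1) := b) refl (re u) (im u))
          ; distrib = (λ u v w →
                solve 7 (λ δ a b c d e f → a :* (c :+ e) :+ δ :* (b :* (d :+ f)) := (a :* c :+ δ :* (b :* d)) :+ (a :* e :+ δ :* (b :* f))) refl
                  δ (re u) (im u) (re v) (im v) (re w) (im w)
              , solve 6 (λ a b c d e f → a :* (d :+ f) :+ b :* (c :+ e) := (a :* d :+ b :* c) :+ (a :* f :+ b :* e)) refl
                  (re u) (im u) (re v) (im v) (re w) (im w))
            , (λ u v w →
                solve 7 (λ δ a b c d e f → (c :+ e) :* a :+ δ :* ((d :+ f) :* b) := (c :* a :+ δ :* (d :* b)) :+ (e :* a :+ δ :* (f :* b))) refl
                  δ (re u) (im u) (re v) (im v) (re w) (im w)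
              , solve 6 (λ a b c d e f → (c :+ e) :* b :+ (d :+ f) :* a := (c :* b :+ d :* a) :+ (e :* b :+ f :* a)) refl
                  (re u) (im u) (re v) (im v) (re w) (im w))
          }
        ; zero = (λ u → solve 3 (λ δ a b → con (+ 0) :* a :+ δ :* (con (+ 0) :* b) := con (+ 0)) refl δ (re u) (im u)
                      , solve 2 (λ a b → con (+ 0) :* b :+ con (+ 0) :* a := con (+ 0)) refl (re u) (im u))
               , (λ u → solve 3 (λ δ a b → a :* con (+ 0) :+ δ :* (b :* con (+ 0)) := con (+ 0)) refl δ (re u) (im u)
                      , solve 2 (λ a b → a :* con (+ 0) :+ b :* con (+ 0) := con (+ 0)) refl (re u) (im u))
        }
      ; *-comm = λ u v → solve 5 (λ δ a b c d → a :* c :+ δ :* (b :* d) := c :* a :+ δ :* (d :* b)) refl δ (re u) (im u) (re v) (im v)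
                       , solve 4 (λ a b c d → a :* d :+ b :* c := c :* b :+ d :* a) refl (re u) (im u) (re v) (im v)
      }
    }


module TraceCriterion {c ℓ} (F : CommutativeRing c ℓ) (isField : IsField F)
                      (_≟_ : Decidable (CommutativeRing._≈_ F))
                      {p : ℕ} (p-prime : Prime p) (3≤p : 3 ≤ p) (ιp≈0 : IntegerCoefficients.CharDivides F p) where

  open CommutativeRing F
  open PSL2 F
  open Matrices F
  open DecidableField F isField _≟_
  open PrimeCharacteristic p-prime ιp≈0

  HasTrace±2 : Mat → Set ℓ
  HasTrace±2 g = tr g ≈ two ⊎ tr g ≈ - two

  two≉0 : ¬ (two ≈ 0#)
  two≉0 = ι≉0 (s≤s z≤n) 3≤p

  ½ : Carrier
  ½ = recip two two≉0

  p≡1+h*2 : p ≡ 1 ℕ.+ (p / 2) ℕ.* 2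
  p≡1+h*2 with p % 2 | m≡m%n+[m/n]*n p 2 | m%n<n p 2
  ... | 1 | p≡1+h*2 | _ = p≡1+h*2
  ... | suc (suc _) | _ | s≤s (s≤s ())
  ... | 0 | p≡h*2 | _ with prime⇒irreducible p-prime (divides (p / 2) p≡h*2)
  ...   | inj₁ ()
  ...   | inj₂ 2≡p = ⊥-elim (ℕP.<⇒≢ 3≤p 2≡p)

  InSL∧≈scalar⇒≈P-I : ∀ {g x} → InSL g → g ≈M scalar x → g ≈P I
  InSL∧≈scalar⇒≈P-I {g} {x} g∈SL g≈x = ≈P-trans (≈M⇒≈P g≈x) (scalar-±1≈P-I (x*x≈y*y⇒x≈y⊎x≈-y (begin
    x * x             ≈⟨ solve 1 (λ x → x :* x := x :* x :- con (+ 0) :* con (+ 0)) refl x ⟩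
    det (scalar x)    ≈⟨ sym (det-cong g≈x) ⟩
    det g             ≈⟨ g∈SL ⟩
    1#                ≈⟨ sym (*-identityˡ 1#) ⟩
    1# * 1#           ∎)))

  -- Writing g = s·I + N with s = tr g / 2, the traceless part N satisfies N² = δ·I; so a + b X ↦ a·I + b·N embeds
  -- F[X]/(X² - δ) into the matrices, sending s + X to g.
  module Decomposition (g : Mat) where

    s n δ : Carrier
    s = tr g * ½
    n = m₁₁ g - s
    δ = n * n + m₁₂ g * m₂₁ g

    open QuadraticExtension F δ public
    open CommutativeSemiring F[√δ] public using () renaming (refl to ≋-refl; trans to ≋-trans; *-cong to ⊗-cong)
    open import Algebra.Properties.Semiring.Exp (CommutativeSemiring.semiring F[√δ]) public
      using () renaming (_^_ to _^ₑ_)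

    toMat : Elem → Mat
    toMat u = mat (re u + im u * n) (im u * m₁₂ g) (im u * m₂₁ g) (re u - im u * n)

    toMat-cong : ∀ {u v} → u ≋ v → toMat u ≈M toMat v
    toMat-cong (e₁ , e₂) = +-cong e₁ (*-congʳ e₂) , *-congʳ e₂ , *-congʳ e₂ , +-cong e₁ (-‿cong (*-congʳ e₂))

    toMat-⊗ : ∀ u v → toMat u · toMat v ≈M toMat (u ⊗ v)
    toMat-⊗ u v =
        solve 7 (λ a b c d n x y → (a :+ b :* n) :* (c :+ d :* n) :+ (b :* x) :* (d :* y)
                                 := (a :* c :+ (n :* n :+ x :* y) :* (b :* d)) :+ (a :* d :+ b :* c) :* n) refl
          (re u) (im u) (re v) (im v) n (m₁₂ g) (m₂₁ g)
      , solve 7 (λ a b c d n x y → (a :+ b :* n) :* (d :* x) :+ (b :* x) :* (c :- d :* n) := (a :* d :+ b :* c) :* x) refl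
          (re u) (im u) (re v) (im v) n (m₁₂ g) (m₂₁ g)
      , solve 7 (λ a b c d n x y → (b :* y) :* (c :+ d :* n) :+ (a :- b :* n) :* (d :* y) := (a :* d :+ b :* c) :* y) refl
          (re u) (im u) (re v) (im v) n (m₁₂ g) (m₂₁ g)
      , solve 7 (λ a b c d n x y → (b :* y) :* (d :* x) :+ (a :- b :* n) :* (c :- d :* n)
                                 := (a :* c :+ (n :* n :+ x :* y) :* (b :* d)) :- (a :* d :+ b :* c) :* n) refl
          (re u) (im u) (re v) (im v) n (m₁₂ g) (m₂₁ g)

    toMat-scalar : ∀ {u} → im u ≈ 0# → toMat u ≈M scalar (re u)
    toMat-scalar {u} im≈0 =
        trans (+-congˡ (trans (*-congʳ im≈0) (zeroˡ n))) (+-identityʳ (re u))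
      , trans (*-congʳ im≈0) (zeroˡ _) , trans (*-congʳ im≈0) (zeroˡ _)
      , trans (+-congˡ (trans (-‿cong (trans (*-congʳ im≈0) (zeroˡ n))) -0#≈0#)) (+-identityʳ (re u))

    two*s≈tr : two * s ≈ tr g
    two*s≈tr = begin
      two * (tr g * ½)   ≈⟨ solve 3 (λ x t y → x :* (t :* y) := t :* (x :* y)) refl two (tr g) ½ ⟩
      tr g * (two * ½)   ≈⟨ *-congˡ (*-recip two two≉0) ⟩
      tr g * 1#          ≈⟨ *-identityʳ (tr g) ⟩
      tr g               ∎

    g≈toMat⟨s,1⟩ : g ≈M toMat ⟨ s , 1# ⟩
    g≈toMat⟨s,1⟩ = solve 2 (λ a s → a := s :+ con (+ 1) :* (a :- s)) refl (m₁₁ g) s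
                 , sym (*-identityˡ _) , sym (*-identityˡ _)
                 , (begin
                     m₂₂ g                      ≈⟨ solve 2 (λ a d → d := (a :+ d) :- a) refl (m₁₁ g) (m₂₂ g) ⟩
                     tr g - m₁₁ g               ≈⟨ +-congʳ (sym two*s≈tr) ⟩
                     two * s - m₁₁ g            ≈⟨ solve 2 (λ a s → (con (+ 1) :+ con (+ 1)) :* s :- a := s :- con (+ 1) :* (a :- s)) refl (m₁₁ g) s ⟩
                     s - 1# * n                 ∎)

    g^m≈toMat : ∀ m → g ^ᴹ m ≈M toMat (⟨ s , 1# ⟩ ^ₑ m)
    g^m≈toMat zero = sym (trans (+-congˡ (zeroˡ n)) (+-identityʳ 1#)) , sym (zeroˡ _) , sym (zeroˡ _)
                   , sym (trans (+-congˡ (trans (-‿cong (zeroˡ n)) -0#≈0#)) (+-identityʳ 1#))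
    g^m≈toMat (suc m) = ≈M-trans (·-cong g≈toMat⟨s,1⟩ (g^m≈toMat m)) (toMat-⊗ ⟨ s , 1# ⟩ (⟨ s , 1# ⟩ ^ₑ m))

    det≈s²-δ : det g ≈ s * s - δ
    det≈s²-δ = begin
      det g                                ≈⟨ det-cong g≈toMat⟨s,1⟩ ⟩
      det (toMat ⟨ s , 1# ⟩)               ≈⟨ solve 4 (λ s n b c → (s :+ con (+ 1) :* n) :* (s :- con (+ 1) :* n) :- (con (+ 1) :* b) :* (con (+ 1) :* c)
                                                                  := s :* s :- (n :* n :+ b :* c)) refl s n (m₁₂ g) (m₂₁ g) ⟩
      s * s - δ                            ∎

    toMat≈P-I⇒g≈scalar : ∀ {x y} → ¬ (y ≈ 0#) → toMat ⟨ x , y ⟩ ≈P I → g ≈M scalar s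
    toMat≈P-I⇒g≈scalar {x} {y} y≉0 ≈I = ≈M-trans g≈toMat⟨s,1⟩
        ( trans (+-congˡ (trans (*-identityˡ n) n≈0)) (+-identityʳ s)
        , trans (*-identityˡ _) b≈0 , trans (*-identityˡ _) c≈0
        , trans (+-congˡ (trans (-‿cong (trans (*-identityˡ n) n≈0)) -0#≈0#)) (+-identityʳ s))
      where
      b≈0 = x≉0∧x*y≈0⇒y≈0 y≉0 (≈P-I⇒m₁₂≈0 ≈I)
      c≈0 = x≉0∧x*y≈0⇒y≈0 y≉0 (≈P-I⇒m₂₁≈0 ≈I)
      n≈0 : n ≈ 0#
      n≈0 = x≉0∧x*y≈0⇒y≈0 y≉0 (x≉0∧x*y≈0⇒y≈0 two≉0 (begin
        two * (y * n)                  ≈⟨ solve 3 (λ x y n → (con (+ 1) :+ con (+ 1)) :* (y :* n) := (x :+ y :* n) :- (x :- y :* n)) refl x y n ⟩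
        (x + y * n) - (x - y * n)      ≈⟨ +-congʳ (≈P-I⇒m₁₁≈m₂₂ ≈I) ⟩
        (x - y * n) - (x - y * n)      ≈⟨ -‿inverseʳ _ ⟩
        0#                             ∎))

    HasTrace±2⇒s*s≈1 : HasTrace±2 g → s * s ≈ 1#
    HasTrace±2⇒s*s≈1 tr±2 = ±1⇒x*x≈1 (s≈±1 tr±2)
      where
      s≈±1 : HasTrace±2 g → s ≈ 1# ⊎ s ≈ - 1#
      s≈±1 (inj₁ tr≈2) = inj₁ (*-cancelˡ two≉0 (trans two*s≈tr (trans tr≈2 (sym (*-identityʳ two)))))
      s≈±1 (inj₂ tr≈-2) = inj₂ (*-cancelˡ two≉0 (trans two*s≈tr (trans tr≈-2
                            (solve 1 (λ t → :- t := t :* (:- con (+ 1))) refl two))))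
      ±1⇒x*x≈1 : ∀ {x} → x ≈ 1# ⊎ x ≈ - 1# → x * x ≈ 1#
      ±1⇒x*x≈1 (inj₁ x≈1) = trans (*-cong x≈1 x≈1) (*-identityˡ 1#)
      ±1⇒x*x≈1 (inj₂ x≈-1) = trans (*-cong x≈-1 x≈-1) (solve 0 (:- con (+ 1) :* :- con (+ 1) := con (+ 1)) refl)

    s*s≈1⇒HasTrace±2 : s * s ≈ 1# → HasTrace±2 g
    s*s≈1⇒HasTrace±2 s*s≈1 with x*x≈y*y⇒x≈y⊎x≈-y (trans s*s≈1 (sym (*-identityˡ 1#)))
    ... | inj₁ s≈1 = inj₁ (trans (sym two*s≈tr) (trans (*-congˡ s≈1) (*-identityʳ two)))
    ... | inj₂ s≈-1 = inj₂ (trans (sym two*s≈tr) (trans (*-congˡ s≈-1) (solve 1 (λ t → t :* (:- con (+ 1)) := :- t) refl two)))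

    InSL⇒δ≈s*s-1 : InSL g → δ ≈ s * s - 1#
    InSL⇒δ≈s*s-1 g∈SL = begin
      δ                     ≈⟨ solve 2 (λ x δ → δ := x :- (x :- δ)) refl (s * s) δ ⟩
      s * s - (s * s - δ)   ≈⟨ +-congˡ (-‿cong (trans (sym det≈s²-δ) g∈SL)) ⟩
      s * s - 1#            ∎

  -- If tr g = ±2 then δ = 0 and s² = 1, so (s + X)ᵐ = sᵐ + m sᵐ⁻¹ X = sᵐ + m sᵐ s X, whose X-coefficient vanishes
  -- exactly when p divides m.
  trace±2⇒order-p : ∀ g → InSL g → HasTrace±2 g → ¬ (g ≈P I) → HasOrder g p
  trace±2⇒order-p g g∈SL tr±2 g≉I = ℕP.<-≤-trans (s≤s z≤n) 3≤p , g^p≈I , g^m≉I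
    where
    open Decomposition g
    s*s≈1 = HasTrace±2⇒s*s≈1 tr±2

    δ≈0 : δ ≈ 0#
    δ≈0 = trans (InSL⇒δ≈s*s-1 g∈SL) (trans (+-congʳ s*s≈1) (-‿inverseʳ 1#))

    s≉0 : ¬ (s ≈ 0#)
    s≉0 s≈0 = 1≉0 (trans (sym s*s≈1) (trans (*-congʳ s≈0) (zeroˡ s)))

    ⟨s,1⟩^m : ∀ m → ⟨ s , 1# ⟩ ^ₑ m ≋ ⟨ s ^ m , ι m * s ^ m * s ⟩
    ⟨s,1⟩^m zero = refl , sym (trans (*-congʳ (zeroˡ 1#)) (zeroˡ s))
    ⟨s,1⟩^m (suc m) = ≋-trans (⊗-cong {⟨ s , 1# ⟩} ≋-refl (⟨s,1⟩^m m))
      ( trans (+-congˡ (trans (*-congʳ δ≈0) (zeroˡ _))) (+-identityʳ _)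
      , (begin
          s * (ι m * sᵐ * s) + 1# * sᵐ                 ≈⟨ solve 3 (λ s M E → s :* (M :* E :* s) :+ con (+ 1) :* E
                                                                 := (con (+ 1) :+ M) :* (s :* E) :* s :+ E :* (con (+ 1) :- s :* s)) refl s (ι m) sᵐ ⟩
          (1# + ι m) * (s * sᵐ) * s + sᵐ * (1# - s * s)  ≈⟨ +-cong (*-congʳ (*-congʳ (sym (ι-suc m)))) (*-congˡ (trans (+-congˡ (-‿cong s*s≈1)) (-‿inverseʳ 1#))) ⟩
          ι (suc m) * (s * sᵐ) * s + sᵐ * 0#            ≈⟨ trans (+-congˡ (zeroʳ sᵐ)) (+-identityʳ _) ⟩
          ι (suc m) * (s * sᵐ) * s                      ∎))
      where sᵐ = s ^ m

    g^m≈ : ∀ m → g ^ᴹ m ≈M toMat ⟨ s ^ m , ι m * s ^ m * s ⟩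
    g^m≈ m = ≈M-trans (g^m≈toMat m) (toMat-cong (⟨s,1⟩^m m))

    g^p≈I : (g ^ᴹ p) ≈P I
    g^p≈I = InSL∧≈scalar⇒≈P-I (InSL-^ᴹ p g∈SL)
      (≈M-trans (g^m≈ p) (toMat-scalar (trans (*-congʳ (trans (*-congʳ ιp≈0) (zeroˡ _))) (zeroˡ s))))

    g^m≉I : ∀ m → 0 < m → m < p → ¬ ((g ^ᴹ m) ≈P I)
    g^m≉I m 0<m m<p g^m≈I = g≉I (InSL∧≈scalar⇒≈P-I g∈SL
      (toMat≈P-I⇒g≈scalar (x*y≉0 (x*y≉0 (ι≉0 0<m m<p) (x^n≉0 m s≉0)) s≉0) (≈P-trans (≈M⇒≈P (≈M-sym (g^m≈ m))) g^m≈I)))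

  -- By Frobenius (s + X)ᵖ = sᵖ + Xᵖ = sᵖ + δ^((p-1)/2) X, so gᵖ = ±I forces δ = 0, that is s² = det g = 1.
  order-p⇒trace±2 : ∀ g → InSL g → HasOrder g p → HasTrace±2 g
  order-p⇒trace±2 g g∈SL (_ , g^p≈I , g^m≉I) = s*s≈1⇒HasTrace±2 s*s≈1
    where
    open Decomposition g
    open Frobenius F[√δ] using (frobenius)
    open import Algebra.Properties.Semiring.Mult (CommutativeSemiring.semiring F[√δ]) using () renaming (_×_ to _×ₑ_)
    open import Algebra.Properties.Semiring.Exp (CommutativeSemiring.semiring F[√δ]) using () renaming (^-congˡ to ^ₑ-congˡ)
    h = p / 2

    g≉I : ¬ (g ≈P I)
    g≉I g≈I = g^m≉I 1 (s≤s z≤n) (ℕP.<-≤-trans (s≤s (s≤s z≤n)) 3≤p) (≈P-trans (≈M⇒≈P (·-identityʳ g)) g≈I)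

    m×1≋ι : ∀ m → m ×ₑ ⟨ 1# , 0# ⟩ ≋ ⟨ ι m , 0# ⟩
    m×1≋ι zero = refl , refl
    m×1≋ι (suc m) = trans (+-congˡ (proj₁ (m×1≋ι m))) (sym (ι-suc m)) , trans (+-congˡ (proj₂ (m×1≋ι m))) (+-identityʳ 0#)

    ⟨s,0⟩^m : ∀ m → ⟨ s , 0# ⟩ ^ₑ m ≋ ⟨ s ^ m , 0# ⟩
    ⟨s,0⟩^m zero = refl , refl
    ⟨s,0⟩^m (suc m) = ≋-trans (⊗-cong {⟨ s , 0# ⟩} ≋-refl (⟨s,0⟩^m m))
      ( solve 3 (λ δ s x → s :* x :+ δ :* (con (+ 0) :* con (+ 0)) := s :* x) refl δ s (s ^ m)
      , solve 2 (λ s x → s :* con (+ 0) :+ con (+ 0) :* x := con (+ 0)) refl s (s ^ m))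

    ⟨0,1⟩^[1+j*2] : ∀ j → ⟨ 0# , 1# ⟩ ^ₑ (1 ℕ.+ j ℕ.* 2) ≋ ⟨ 0# , δ ^ j ⟩
    ⟨0,1⟩^[1+j*2] zero =
        solve 1 (λ δ → con (+ 0) :* con (+ 1) :+ δ :* (con (+ 1) :* con (+ 0)) := con (+ 0)) refl δ
      , solve 0 (con (+ 0) :* con (+ 0) :+ con (+ 1) :* con (+ 1) := con (+ 1)) refl
    ⟨0,1⟩^[1+j*2] (suc j) = ≋-trans (⊗-cong {⟨ 0# , 1# ⟩} ≋-refl (⊗-cong {⟨ 0# , 1# ⟩} ≋-refl (⟨0,1⟩^[1+j*2] j)))
      ( solve 2 (λ δ D → con (+ 0) :* (con (+ 0) :* con (+ 0) :+ δ :* (con (+ 1) :* D))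
                          :+ δ :* (con (+ 1) :* (con (+ 0) :* D :+ con (+ 1) :* con (+ 0))) := con (+ 0)) refl δ (δ ^ j)
      , solve 2 (λ δ D → con (+ 0) :* (con (+ 0) :* D :+ con (+ 1) :* con (+ 0))
                          :+ con (+ 1) :* (con (+ 0) :* con (+ 0) :+ δ :* (con (+ 1) :* D)) := δ :* D) refl δ (δ ^ j))

    ⟨s,1⟩^p : ⟨ s , 1# ⟩ ^ₑ p ≋ ⟨ s ^ p , δ ^ h ⟩
    ⟨s,1⟩^p = ≋-trans (^ₑ-congˡ p (sym (+-identityʳ s) , sym (+-identityˡ 1#)))
             (≋-trans (frobenius p-prime (≋-trans (m×1≋ι p) (ιp≈0 , refl)) ⟨ s , 0# ⟩ ⟨ 0# , 1# ⟩)
             (≋-trans (+-cong (proj₁ (⟨s,0⟩^m p)) (proj₁ ⟨0,1⟩^p) , +-cong (proj₂ (⟨s,0⟩^m p)) (proj₂ ⟨0,1⟩^p))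
                      (+-identityʳ _ , +-identityˡ _)))
      where
      ⟨0,1⟩^p : ⟨ 0# , 1# ⟩ ^ₑ p ≋ ⟨ 0# , δ ^ h ⟩
      ⟨0,1⟩^p = ≡.subst (λ k → ⟨ 0# , 1# ⟩ ^ₑ k ≋ ⟨ 0# , δ ^ h ⟩) (≡.sym p≡1+h*2) (⟨0,1⟩^[1+j*2] h)

    δ≈0 : δ ≈ 0#
    δ≈0 with δ ≟ 0#
    ... | yes δ≈0 = δ≈0
    ... | no δ≉0 = ⊥-elim (g≉I (InSL∧≈scalar⇒≈P-I g∈SL (toMat≈P-I⇒g≈scalar (x^n≉0 h δ≉0)
             (≈P-trans (≈M⇒≈P (≈M-sym (≈M-trans (g^m≈toMat p) (toMat-cong ⟨s,1⟩^p)))) g^p≈I))))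

    s*s≈1 : s * s ≈ 1#
    s*s≈1 = begin
      s * s                 ≈⟨ solve 2 (λ x y → x := (x :- y) :+ y) refl (s * s) 1# ⟩
      (s * s - 1#) + 1#     ≈⟨ +-congʳ (trans (sym (InSL⇒δ≈s*s-1 g∈SL)) δ≈0) ⟩
      0# + 1#               ≈⟨ +-identityˡ 1# ⟩
      1#                    ∎


module Neighbourhood {c ℓ} (F : CommutativeRing c ℓ) (isField : IsField F)
                     (_≟_ : Decidable (CommutativeRing._≈_ F))
                     {p : ℕ} (p-prime : Prime p) (5≤p : 5 ≤ p) (ιp≈0 : IntegerCoefficients.CharDivides F p) where

  open CommutativeRing F
  open PSL2 F
  open Matrices F
  open DecidableField F isField _≟_
  open PrimeCharacteristic p-prime ιp≈0
  open TraceCriterion F isField _≟_ p-prime (ℕP.≤-trans (s≤s (s≤s (s≤s z≤n))) 5≤p) ιp≈0 public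

  four≉0 : ¬ (four ≈ 0#)
  four≉0 four≈0 = ι≉0 (s≤s z≤n) 5≤p (trans (solve 0 (((con (+ 1) :+ con (+ 1)) :+ con (+ 1)) :+ con (+ 1)
                                                      := (con (+ 1) :+ con (+ 1)) :+ (con (+ 1) :+ con (+ 1))) refl) four≈0)

  ¼ : Carrier
  ¼ = recip four four≉0

  HasTrace±2-resp-≈P : ∀ {g h} → g ≈P h → HasTrace±2 h → HasTrace±2 g
  HasTrace±2-resp-≈P (inj₁ g≈h) tr±2 = Data.Sum.map (trans (tr-cong g≈h)) (trans (tr-cong g≈h)) tr±2
  HasTrace±2-resp-≈P {h = h} (inj₂ g≈-h) (inj₁ tr≈2) = inj₂ (trans (tr-cong g≈-h) (trans (tr-neg h) (-‿cong tr≈2)))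
  HasTrace±2-resp-≈P {h = h} (inj₂ g≈-h) (inj₂ tr≈-2) =
    inj₁ (trans (tr-cong g≈-h) (trans (tr-neg h) (trans (-‿cong tr≈-2) (-‿involutive two))))

  InCp-intro : ∀ {g} → InSL g → HasTrace±2 g → ¬ (g ≈P I) → InCp p g
  InCp-intro {g} g∈SL tr±2 g≉I = g∈SL , trace±2⇒order-p g g∈SL tr±2 g≉I

  InCp⇒HasTrace±2 : ∀ {g} → InCp p g → HasTrace±2 g
  InCp⇒HasTrace±2 {g} (g∈SL , order) = order-p⇒trace±2 g g∈SL order

  InCp⇒≉I : ∀ {g} → InCp p g → ¬ (g ≈P I)
  InCp⇒≉I {g} (_ , _ , _ , g^m≉I) g≈I =
    g^m≉I 1 (s≤s z≤n) (ℕP.<-≤-trans (s≤s (s≤s z≤n)) 5≤p) (≈P-trans (≈M⇒≈P (·-identityʳ g)) g≈I)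

  Adj-intro : ∀ {g h} → InSL g → InSL h → ¬ (g ≈P h) → HasTrace±2 (h · inv g) → Adj p g h
  Adj-intro {g} {h} g∈SL h∈SL g≉h tr±2 =
    g≉h , InCp-intro (InSL-quotient g h g∈SL h∈SL) tr±2 (λ hg⁻¹≈I → g≉h (≈P-sym (quotient≈P-I⇒≈P g h g∈SL hg⁻¹≈I)))

  Adj⇒HasTrace±2 : ∀ {g h} → Adj p g h → HasTrace±2 (h · inv g)
  Adj⇒HasTrace±2 (_ , hg⁻¹∈Cp) = InCp⇒HasTrace±2 hg⁻¹∈Cp

  T∈SL : ∀ x → InSL (T x)
  T∈SL x = solve 1 (λ x → con (+ 1) :* con (+ 1) :- x :* con (+ 0) := con (+ 1)) refl x

  S∈SL : ∀ x → InSL (S x)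
  S∈SL x = solve 1 (λ x → (con (+ 1) :+ 𝟜 :* x) :* (con (+ 1) :- 𝟜 :* x) :- (:- (𝟜 :* (x :* x))) :* 𝟜 := con (+ 1)) refl x
    where 𝟜 = (con (+ 1) :+ con (+ 1)) :+ (con (+ 1) :+ con (+ 1))

  tr[T·T⁻¹] : ∀ x y → tr (T y · inv (T x)) ≈ two
  tr[T·T⁻¹] x y = solve 2 (λ x y → (con (+ 1) :* con (+ 1) :+ y :* (:- con (+ 0))) :+ (con (+ 0) :* (:- x) :+ con (+ 1) :* con (+ 1))
                                  := con (+ 1) :+ con (+ 1)) refl x y

  tr[S·T⁻¹] : ∀ x y → tr (S y · inv (T x)) ≈ two - four * x
  tr[S·T⁻¹] x y = solve 2 (λ x y → ((con (+ 1) :+ 𝟜 :* y) :* con (+ 1) :+ (:- (𝟜 :* (y :* y))) :* (:- con (+ 0)))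
                                   :+ (𝟜 :* (:- x) :+ (con (+ 1) :- 𝟜 :* y) :* con (+ 1))
                                  := (con (+ 1) :+ con (+ 1)) :- 𝟜 :* x) refl x y
    where 𝟜 = (con (+ 1) :+ con (+ 1)) :+ (con (+ 1) :+ con (+ 1))

  tr[S·S⁻¹] : ∀ a b → tr (S b · inv (S a)) ≈ two + four * ((two * (b - a)) * (two * (b - a)))
  tr[S·S⁻¹] a b = solve 2 (λ a b → ((con (+ 1) :+ 𝟜 :* b) :* (con (+ 1) :- 𝟜 :* a) :+ (:- (𝟜 :* (b :* b))) :* (:- 𝟜))
                                   :+ (𝟜 :* (:- (:- (𝟜 :* (a :* a)))) :+ (con (+ 1) :- 𝟜 :* b) :* (con (+ 1) :+ 𝟜 :* a))
                                  := 𝟚 :+ 𝟜 :* ((𝟚 :* (b :- a)) :* (𝟚 :* (b :- a)))) refl a b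
    where
    𝟚 = con (+ 1) :+ con (+ 1)
    𝟜 = 𝟚 :+ 𝟚

  module UnipotentCoordinates (g : Mat) (g∈SL : InSL g) (tr≈2 : tr g ≈ two) where
    a = m₁₁ g
    b = m₁₂ g
    c′ = m₂₁ g
    d = m₂₂ g

    d≈2-a : d ≈ two - a
    d≈2-a = begin
      d             ≈⟨ solve 2 (λ a d → d := (a :+ d) :- a) refl a d ⟩
      (a + d) - a   ≈⟨ +-congʳ tr≈2 ⟩
      two - a       ∎

    tr[gR⁻¹]≈2-c : tr (g · inv R) ≈ two - c′
    tr[gR⁻¹]≈2-c = begin
      tr (g · inv R)   ≈⟨ solve 4 (λ a b c d → (a :* con (+ 1) :+ b :* (:- con (+ 0))) :+ (c :* (:- con (+ 1)) :+ d :* con (+ 1))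
                                             := (a :+ d) :- c) refl a b c′ d ⟩
      (a + d) - c′     ≈⟨ +-congʳ tr≈2 ⟩
      two - c′         ∎

    [a-1]²≈-bc : (a - 1#) * (a - 1#) ≈ - (b * c′)
    [a-1]²≈-bc = begin
      (a - 1#) * (a - 1#)             ≈⟨ solve 3 (λ a b c → (a :- con (+ 1)) :* (a :- con (+ 1))
                                                     := (con (+ 1) :- (a :* ((con (+ 1) :+ con (+ 1)) :- a) :- b :* c)) :- b :* c) refl a b c′ ⟩
      (1# - (a * (two - a) - b * c′)) - b * c′  ≈⟨ +-congʳ (+-congˡ (-‿cong (trans (+-congʳ (*-congˡ (sym d≈2-a))) g∈SL))) ⟩
      (1# - 1#) - b * c′              ≈⟨ solve 2 (λ u x → (u :- u) :- x := :- x) refl 1# (b * c′) ⟩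
      - (b * c′)                      ∎

    c≈0⇒≈T : c′ ≈ 0# → g ≈M T b
    c≈0⇒≈T c≈0 = a≈1 , refl , c≈0 , trans d≈2-a (trans (+-congˡ (-‿cong a≈1)) (solve 0 ((con (+ 1) :+ con (+ 1)) :- con (+ 1) := con (+ 1)) refl))
      where
      a≈1 : a ≈ 1#
      a≈1 = x∙y⁻¹≈ε⇒x≈y _ _ (x*x≈0⇒x≈0 (trans [a-1]²≈-bc (trans (-‿cong (trans (*-congˡ c≈0) (zeroʳ b))) -0#≈0#)))

    c≈4⇒≈S : c′ ≈ four → g ≈M S ((a - 1#) * ¼)
    c≈4⇒≈S c≈4 = a≈1+4x , b≈-4x² , c≈4 , d≈1-4x
      where
      x = (a - 1#) * ¼
      4¼≈1 : four * ¼ ≈ 1#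
      4¼≈1 = *-recip four four≉0
      4x≈a-1 : four * x ≈ a - 1#
      4x≈a-1 = trans (solve 3 (λ f a q → f :* (a :* q) := a :* (f :* q)) refl four (a - 1#) ¼) (trans (*-congˡ 4¼≈1) (*-identityʳ _))
      a≈1+4x : a ≈ 1# + four * x
      a≈1+4x = trans (solve 1 (λ a → a := con (+ 1) :+ (a :- con (+ 1))) refl a) (+-congˡ (sym 4x≈a-1))
      d≈1-4x : d ≈ 1# - four * x
      d≈1-4x = trans d≈2-a (trans (solve 1 (λ a → (con (+ 1) :+ con (+ 1)) :- a := con (+ 1) :- (a :- con (+ 1))) refl a)
                                  (+-congˡ (-‿cong (sym 4x≈a-1))))
      b≈-4x² : b ≈ - (four * (x * x))
      b≈-4x² = begin
        b                                      ≈⟨ sym (trans (*-congˡ 4¼≈1) (*-identityʳ b)) ⟩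
        b * (four * ¼)                         ≈⟨ sym (*-assoc b four ¼) ⟩
        (b * four) * ¼                         ≈⟨ *-congʳ (*-congˡ (sym c≈4)) ⟩
        (b * c′) * ¼                           ≈⟨ *-congʳ (trans (sym (-‿involutive _)) (-‿cong (sym [a-1]²≈-bc))) ⟩
        (- ((a - 1#) * (a - 1#))) * ¼          ≈⟨ sym (-‿distribˡ-* _ ¼) ⟩
        - ((a - 1#) * (a - 1#) * ¼)            ≈⟨ -‿cong (sym 4x²≈[a-1]²¼) ⟩
        - (four * (x * x))                     ∎
        where
        4x²≈[a-1]²¼ : four * (x * x) ≈ (a - 1#) * (a - 1#) * ¼
        4x²≈[a-1]²¼ = begin
          four * (x * x)                        ≈⟨ solve 3 (λ f A q → f :* ((A :* q) :* (A :* q)) := (A :* A :* q) :* (f :* q)) refl four (a - 1#) ¼ ⟩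
          (a - 1#) * (a - 1#) * ¼ * (four * ¼)  ≈⟨ *-congˡ 4¼≈1 ⟩
          (a - 1#) * (a - 1#) * ¼ * 1#          ≈⟨ *-identityʳ _ ⟩
          (a - 1#) * (a - 1#) * ¼               ∎

  neighbour-of-R : ∀ g → InSL g → tr g ≈ two → HasTrace±2 (g · inv R) → (∃ λ x → g ≈M T x) ⊎ (∃ λ x → g ≈M S x)
  neighbour-of-R g g∈SL tr≈2 (inj₁ t≈2) = inj₁ (b , c≈0⇒≈T (begin
      c′                         ≈⟨ solve 2 (λ t c → c := t :- (t :- c)) refl two c′ ⟩
      two - (two - c′)           ≈⟨ +-congˡ (-‿cong (trans (sym tr[gR⁻¹]≈2-c) t≈2)) ⟩
      two - two                  ≈⟨ -‿inverseʳ two ⟩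
      0#                         ∎))
    where open UnipotentCoordinates g g∈SL tr≈2
  neighbour-of-R g g∈SL tr≈2 (inj₂ t≈-2) = inj₂ (_ , c≈4⇒≈S (begin
      c′                         ≈⟨ solve 2 (λ t c → c := t :- (t :- c)) refl two c′ ⟩
      two - (two - c′)           ≈⟨ +-congˡ (-‿cong (trans (sym tr[gR⁻¹]≈2-c) t≈-2)) ⟩
      two - - two                ≈⟨ solve 0 ((con (+ 1) :+ con (+ 1)) :- :- (con (+ 1) :+ con (+ 1))
                                             := (con (+ 1) :+ con (+ 1)) :+ (con (+ 1) :+ con (+ 1))) refl ⟩
      four                       ∎))
    where open UnipotentCoordinates g g∈SL tr≈2

  T-cong : ∀ {x y} → x ≈ y → T x ≈M T y
  T-cong x≈y = refl , x≈y , refl , refl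

  S-cong : ∀ {x y} → x ≈ y → S x ≈M S y
  S-cong x≈y = +-congˡ (*-congˡ x≈y) , -‿cong (*-congˡ (*-cong x≈y x≈y)) , refl , +-congˡ (-‿cong (*-congˡ x≈y))

  T-injective : ∀ {x y} → T x ≈P T y → x ≈ y
  T-injective (inj₁ (_ , x≈y , _ , _)) = x≈y
  T-injective (inj₂ (1≈-1 , _ , _ , _)) = ⊥-elim (two≉0 (trans (+-congˡ 1≈-1) (-‿inverseʳ 1#)))

  S-injective : ∀ {a b} → S a ≈P S b → a ≈ b
  S-injective {a} {b} (inj₁ (e , _ , _ , _)) = *-cancelˡ four≉0 (begin
    four * a                ≈⟨ solve 2 (λ f a → f :* a := (con (+ 1) :+ f :* a) :- con (+ 1)) refl four a ⟩
    (1# + four * a) - 1#    ≈⟨ +-congʳ e ⟩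
    (1# + four * b) - 1#    ≈⟨ solve 2 (λ f b → (con (+ 1) :+ f :* b) :- con (+ 1) := f :* b) refl four b ⟩
    four * b                ∎)
  S-injective (inj₂ (_ , _ , 4≈-4 , _)) = ⊥-elim (x*y≉0 two≉0 four≉0 (begin
    two * four              ≈⟨ solve 1 (λ f → (con (+ 1) :+ con (+ 1)) :* f := f :+ f) refl four ⟩
    four + four             ≈⟨ +-congʳ 4≈-4 ⟩
    - four + four           ≈⟨ -‿inverseˡ four ⟩
    0#                      ∎))

  T≉S : ∀ x y → ¬ (T x ≈P S y)
  T≉S x y (inj₁ (_ , _ , 0≈4 , _)) = four≉0 (sym 0≈4)
  T≉S x y (inj₂ (_ , _ , 0≈-4 , _)) = four≉0 (trans (sym (-‿involutive four)) (trans (-‿cong (sym 0≈-4)) -0#≈0#))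

  S≉I : ∀ y → ¬ (S y ≈P I)
  S≉I y S≈I = four≉0 (≈P-I⇒m₂₁≈0 S≈I)

  N[R]∧≈P-trace-2⇒InΓ̃ : ∀ {g} g′ → InCp p g → Adj p R g → g ≈P g′ → InSL g′ → tr g′ ≈ two → InΓ̃ g
  N[R]∧≈P-trace-2⇒InΓ̃ {g} g′ g∈Cp adj g≈g′ g′∈SL tr≈2 = case (neighbour-of-R g′ g′∈SL tr≈2 tr[g′R⁻¹]±2)
    where
    tr[g′R⁻¹]±2 : HasTrace±2 (g′ · inv R)
    tr[g′R⁻¹]±2 = HasTrace±2-resp-≈P (quotient-resp-≈P (≈P-refl {R}) (≈P-sym g≈g′)) (Adj⇒HasTrace±2 adj)
    case : (∃ λ x → g′ ≈M T x) ⊎ (∃ λ x → g′ ≈M S x) → InΓ̃ g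
    case (inj₁ (x , g′≈T)) = inj₁ ((x , ≈P-trans g≈g′ (≈M⇒≈P g′≈T)) , InCp⇒≉I g∈Cp , λ g≈R → proj₁ adj (≈P-sym g≈R))
    case (inj₂ (x , g′≈S)) = inj₂ (x , ≈P-trans g≈g′ (≈M⇒≈P g′≈S))

  N[R]⇒InΓ̃ : ∀ g → InCp p g × Adj p R g → InΓ̃ g
  N[R]⇒InΓ̃ g (g∈Cp , adj) = case (InCp⇒HasTrace±2 g∈Cp)
    where
    case : HasTrace±2 g → InΓ̃ g
    case (inj₁ tr≈2) = N[R]∧≈P-trace-2⇒InΓ̃ g g∈Cp adj ≈P-refl (proj₁ g∈Cp) tr≈2
    case (inj₂ tr≈-2) = N[R]∧≈P-trace-2⇒InΓ̃ (neg g) g∈Cp adj (inj₂ (≈M-sym (neg-involutive g)))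
                          (trans (det-neg g) (proj₁ g∈Cp)) (trans (tr-neg g) (trans (-‿cong tr≈-2) (-‿involutive two)))

  InΓ̃⇒N[R] : ∀ g → InΓ̃ g → InCp p g × Adj p R g
  InΓ̃⇒N[R] g (inj₁ ((x , g≈T) , g≉I , g≉R)) =
      InCp-intro g∈SL (HasTrace±2-resp-≈P g≈T (inj₁ refl)) g≉I
    , Adj-intro (T∈SL 1#) g∈SL (g≉R ∘ ≈P-sym) (HasTrace±2-resp-≈P (quotient-resp-≈P (≈P-refl {R}) g≈T) (inj₁ (tr[T·T⁻¹] 1# x)))
    where g∈SL = InSL-resp-≈P g≈T (T∈SL x)
  InΓ̃⇒N[R] g (inj₂ (x , g≈S)) =
      InCp-intro g∈SL (HasTrace±2-resp-≈P g≈S (inj₁ (trS x))) (S≉I x ∘ ≈P-trans (≈P-sym g≈S))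
    , Adj-intro (T∈SL 1#) g∈SL (T≉S 1# x ∘ flip ≈P-trans g≈S)
        (HasTrace±2-resp-≈P (quotient-resp-≈P (≈P-refl {R}) g≈S) (inj₂ (trans (tr[S·T⁻¹] 1# x) 2-4≈-2)))
    where
    g∈SL = InSL-resp-≈P g≈S (S∈SL x)
    trS : ∀ x → tr (S x) ≈ two
    trS x = solve 1 (λ x → (con (+ 1) :+ 𝟜 :* x) :+ (con (+ 1) :- 𝟜 :* x) := con (+ 1) :+ con (+ 1)) refl x
      where 𝟜 = (con (+ 1) :+ con (+ 1)) :+ (con (+ 1) :+ con (+ 1))
    2-4≈-2 : two - four * 1# ≈ - two
    2-4≈-2 = solve 0 ((con (+ 1) :+ con (+ 1)) :- ((con (+ 1) :+ con (+ 1)) :+ (con (+ 1) :+ con (+ 1))) :* con (+ 1)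
                      := :- (con (+ 1) :+ con (+ 1))) refl

  N[R]⇔InΓ̃ : ∀ g → (InCp p g × Adj p R g) ⇔ InΓ̃ g
  N[R]⇔InΓ̃ g = mk⇔ (N[R]⇒InΓ̃ g) (InΓ̃⇒N[R] g)

  C∖IR∩𝒞≡∅ : ∀ g h → InC∖IR g → InScrC h → ¬ (g ≈P h)
  C∖IR∩𝒞≡∅ g h ((x , g≈T) , _) (y , h≈S) g≈h = T≉S x y (≈P-trans (≈P-sym g≈T) (≈P-trans g≈h h≈S))

  tr[S·T⁻¹]≈t⇒4x≈2-t : ∀ {x y t} → tr (S y · inv (T x)) ≈ t → four * x ≈ two - t
  tr[S·T⁻¹]≈t⇒4x≈2-t {x} {y} {t} tr≈t = begin
    four * x                ≈⟨ solve 2 (λ f x → f :* x := (con (+ 1) :+ con (+ 1)) :- ((con (+ 1) :+ con (+ 1)) :- f :* x)) refl four x ⟩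
    two - (two - four * x)  ≈⟨ +-congˡ (-‿cong (trans (sym (tr[S·T⁻¹] x y)) tr≈t)) ⟩
    two - t                 ∎

  C∖IR-𝒞-nonadjacent : ∀ g h → InC∖IR g → InScrC h → ¬ Adj p g h
  C∖IR-𝒞-nonadjacent g h ((x , g≈T) , g≉I , g≉R) (y , h≈S) adj =
    case (HasTrace±2-resp-≈P (≈P-sym (quotient-resp-≈P g≈T h≈S)) (Adj⇒HasTrace±2 adj))
    where
    case : HasTrace±2 (S y · inv (T x)) → ⊥
    case (inj₁ t≈2) = g≉I (≈P-trans g≈T (≈M⇒≈P (T-cong (*-cancelˡ four≉0 (trans (tr[S·T⁻¹]≈t⇒4x≈2-t t≈2)
      (solve 1 (λ f → (con (+ 1) :+ con (+ 1)) :- (con (+ 1) :+ con (+ 1)) := f :* con (+ 0)) refl four))))))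
    case (inj₂ t≈-2) = g≉R (≈P-trans g≈T (≈M⇒≈P (T-cong (*-cancelˡ four≉0 (trans (tr[S·T⁻¹]≈t⇒4x≈2-t t≈-2)
      (solve 0 ((con (+ 1) :+ con (+ 1)) :- :- (con (+ 1) :+ con (+ 1))
                := ((con (+ 1) :+ con (+ 1)) :+ (con (+ 1) :+ con (+ 1))) :* con (+ 1)) refl))))))

  C∖IR-clique : ∀ g h → InC∖IR g → InC∖IR h → ¬ (g ≈P h) → Adj p g h
  C∖IR-clique g h ((x , g≈T) , _) ((y , h≈T) , _) g≉h =
    Adj-intro (InSL-resp-≈P g≈T (T∈SL x)) (InSL-resp-≈P h≈T (T∈SL y)) g≉h
      (HasTrace±2-resp-≈P (quotient-resp-≈P g≈T h≈T) (inj₁ (tr[T·T⁻¹] x y)))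

  Is√-1 : Carrier → Set ℓ
  Is√-1 i = i * i ≈ - 1#

  Adj-𝒞⇒ : ∀ {g h a b} → g ≈P S a → h ≈P S b → Adj p g h → ¬ (a ≈ b) × Is√-1 (two * (b - a))
  Adj-𝒞⇒ {g} {h} {a} {b} g≈S h≈S adj = a≉b , is√-1
    where
    a≉b : ¬ (a ≈ b)
    a≉b a≈b = proj₁ adj (≈P-trans g≈S (≈P-trans (≈M⇒≈P (S-cong a≈b)) (≈P-sym h≈S)))
    i = two * (b - a)
    4i²≈t-2 : ∀ {t} → tr (S b · inv (S a)) ≈ t → four * (i * i) ≈ t - two
    4i²≈t-2 {t} tr≈t = begin
      four * (i * i)                  ≈⟨ solve 2 (λ t x → x := (t :+ x) :- t) refl two (four * (i * i)) ⟩
      (two + four * (i * i)) - two    ≈⟨ +-congʳ (trans (sym (tr[S·S⁻¹] a b)) tr≈t) ⟩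
      t - two                         ∎
    is√-1 : Is√-1 i
    is√-1 = case (HasTrace±2-resp-≈P (≈P-sym (quotient-resp-≈P g≈S h≈S)) (Adj⇒HasTrace±2 adj))
      where
      case : HasTrace±2 (S b · inv (S a)) → Is√-1 i
      case (inj₁ t≈2) = ⊥-elim (a≉b (sym (x∙y⁻¹≈ε⇒x≈y _ _ (x≉0∧x*y≈0⇒y≈0 two≉0 (x*x≈0⇒x≈0
                       (x≉0∧x*y≈0⇒y≈0 four≉0 (trans (4i²≈t-2 t≈2) (-‿inverseʳ two))))))))
      case (inj₂ t≈-2) = *-cancelˡ four≉0 (trans (4i²≈t-2 t≈-2)
                        (solve 0 (:- (con (+ 1) :+ con (+ 1)) :- (con (+ 1) :+ con (+ 1))
                                 := ((con (+ 1) :+ con (+ 1)) :+ (con (+ 1) :+ con (+ 1))) :* :- con (+ 1)) refl))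

  ⇒Adj-𝒞 : ∀ {g h a b} → g ≈P S a → h ≈P S b → ¬ (a ≈ b) → Is√-1 (two * (b - a)) → Adj p g h
  ⇒Adj-𝒞 {g} {h} {a} {b} g≈S h≈S a≉b is√-1 =
    Adj-intro (InSL-resp-≈P g≈S (S∈SL a)) (InSL-resp-≈P h≈S (S∈SL b)) (a≉b ∘ S-injective ∘ g≈h⇒Sa≈Sb)
      (HasTrace±2-resp-≈P (quotient-resp-≈P g≈S h≈S) (inj₂ (begin
        tr (S b · inv (S a))                                    ≈⟨ tr[S·S⁻¹] a b ⟩
        two + four * ((two * (b - a)) * (two * (b - a)))        ≈⟨ +-congˡ (*-congˡ is√-1) ⟩
        two + four * - 1#                                       ≈⟨ solve 0 ((con (+ 1) :+ con (+ 1)) :+ ((con (+ 1) :+ con (+ 1)) :+ (con (+ 1) :+ con (+ 1))) :* :- con (+ 1)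
                                                                          := :- (con (+ 1) :+ con (+ 1))) refl ⟩
        - two                                                   ∎)))
    where
    g≈h⇒Sa≈Sb : g ≈P h → S a ≈P S b
    g≈h⇒Sa≈Sb g≈h = ≈P-trans (≈P-sym g≈S) (≈P-trans g≈h h≈S)


all⊎any : ∀ {m a b} {A : Fin m → Set a} {B : Fin m → Set b} → (∀ i → A i ⊎ B i) → (∀ i → A i) ⊎ (∃ λ i → B i)
all⊎any {zero} _ = inj₁ (λ ())
all⊎any {suc m} A⊎B with A⊎B Fin.zero | all⊎any (A⊎B ∘ Fin.suc)
... | inj₂ b | _ = inj₂ (Fin.zero , b)
... | inj₁ _ | inj₂ (i , b) = inj₂ (Fin.suc i , b)
... | inj₁ a | inj₁ as = inj₁ (λ { Fin.zero → a ; (Fin.suc i) → as i })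

module _ {n : ℕ} {i₀ i₁ : Fin (suc (suc n))} (i₀≢i₁ : i₀ ≢ i₁) where

  skip₂ : Fin n → Fin (suc (suc n))
  skip₂ i = punchIn i₀ (punchIn (punchOut i₀≢i₁) i)

  skip₂-injective : ∀ i j → skip₂ i ≡ skip₂ j → i ≡ j
  skip₂-injective i j eq = FinP.punchIn-injective (punchOut i₀≢i₁) i j (FinP.punchIn-injective i₀ _ _ eq)

  skip₂≢i₀ : ∀ i → skip₂ i ≢ i₀
  skip₂≢i₀ i = FinP.punchInᵢ≢i i₀ (punchIn (punchOut i₀≢i₁) i)

  skip₂≢i₁ : ∀ i → skip₂ i ≢ i₁
  skip₂≢i₁ i eq = FinP.punchInᵢ≢i (punchOut i₀≢i₁) i
    (FinP.punchIn-injective i₀ _ _ (≡.trans eq (≡.sym (FinP.punchIn-punchOut i₀≢i₁))))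

  skip₂-surjective : ∀ j → i₀ ≢ j → j ≢ i₁ → ∃ λ i → skip₂ i ≡ j
  skip₂-surjective j i₀≢j j≢i₁ = punchOut j′≢ , ≡.trans (≡.cong (punchIn i₀) (FinP.punchIn-punchOut j′≢)) (FinP.punchIn-punchOut i₀≢j)
    where
    j′≢ : punchOut i₀≢i₁ ≢ punchOut i₀≢j
    j′≢ eq = j≢i₁ (FinP.punchOut-injective i₀≢j i₀≢i₁ (≡.sym eq))

  avoiding-i₀-i₁⇒≤ : ∀ {m} (f : Fin m → Fin (suc (suc n))) → (∀ i j → f i ≡ f j → i ≡ j)
                     → (∀ i → f i ≢ i₀) → (∀ i → f i ≢ i₁) → m ≤ n
  avoiding-i₀-i₁⇒≤ {m} f f-injective f≢i₀ f≢i₁ = FinP.injective⇒≤ {f = f′} (λ {i} {j} eq → f-injective i j (f′-injective i j eq))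
    where
    f≢i₀′ : ∀ i → i₀ ≢ f i
    f≢i₀′ i = f≢i₀ i ∘ ≡.sym
    f≢i₁′ : ∀ i → punchOut i₀≢i₁ ≢ punchOut (f≢i₀′ i)
    f≢i₁′ i eq = f≢i₁ i (FinP.punchOut-injective (f≢i₀′ i) i₀≢i₁ (≡.sym eq))
    f′ : Fin m → Fin n
    f′ i = punchOut (f≢i₁′ i)
    f′-injective : ∀ i j → f′ i ≡ f′ j → f i ≡ f j
    f′-injective i j eq = FinP.punchOut-injective (f≢i₀′ i) (f≢i₀′ j) (FinP.punchOut-injective (f≢i₁′ i) (f≢i₁′ j) eq)

module CliqueNumber {c ℓ} (F : CommutativeRing c ℓ) (isField : IsField F)
                    (_≟_ : Decidable (CommutativeRing._≈_ F))
                    {p : ℕ} (p-prime : Prime p) (5≤p : 5 ≤ p) (ιp≈0 : IntegerCoefficients.CharDivides F p) where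

  open CommutativeRing F
  open PSL2 F
  open Matrices F
  open DecidableField F isField _≟_
  open PrimeCharacteristic p-prime ιp≈0
  open Neighbourhood F isField _≟_ p-prime 5≤p ιp≈0

  -- If u, v and u + v all square to -1 then 2uv = 1, while v = ±u gives 2uv = ∓2; this needs 2 ≠ 0 and 3 ≠ 0.
  ¬√-1-triangle : ∀ u v → Is√-1 u → Is√-1 v → Is√-1 (u + v) → ⊥
  ¬√-1-triangle u v u²≈-1 v²≈-1 [u+v]²≈-1 = case (x*x≈y*y⇒x≈y⊎x≈-y (trans v²≈-1 (sym u²≈-1)))
    where
    2uv≈1 : two * (u * v) ≈ 1#
    2uv≈1 = begin
      two * (u * v)                          ≈⟨ solve 2 (λ u v → (con (+ 1) :+ con (+ 1)) :* (u :* v) := (u :+ v) :* (u :+ v) :- u :* u :- v :* v) refl u v ⟩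
      (u + v) * (u + v) - u * u - v * v      ≈⟨ +-cong (+-cong [u+v]²≈-1 (-‿cong u²≈-1)) (-‿cong v²≈-1) ⟩
      - 1# - - 1# - - 1#                     ≈⟨ solve 0 (:- con (+ 1) :- :- con (+ 1) :- :- con (+ 1) := con (+ 1)) refl ⟩
      1#                                     ∎
    case : v ≈ u ⊎ v ≈ - u → ⊥
    case (inj₁ v≈u) = ι≉0 (s≤s z≤n) (ℕP.≤-trans (s≤s (s≤s (s≤s (s≤s z≤n)))) 5≤p) (begin
      (1# + 1#) + 1#                         ≈⟨ solve 0 ((con (+ 1) :+ con (+ 1)) :+ con (+ 1) := con (+ 1) :- (con (+ 1) :+ con (+ 1)) :* :- con (+ 1)) refl ⟩
      1# - two * - 1#                        ≈⟨ +-congˡ (-‿cong (*-congˡ (sym u²≈-1))) ⟩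
      1# - two * (u * u)                     ≈⟨ +-congˡ (-‿cong (*-congˡ (*-congˡ (sym v≈u)))) ⟩
      1# - two * (u * v)                     ≈⟨ +-congˡ (-‿cong 2uv≈1) ⟩
      1# - 1#                                ≈⟨ -‿inverseʳ 1# ⟩
      0#                                     ∎)
    case (inj₂ v≈-u) = 1≉0 (begin
      1#                                     ≈⟨ solve 0 (con (+ 1) := (con (+ 1) :+ con (+ 1)) :* (:- (:- con (+ 1))) :- con (+ 1)) refl ⟩
      two * - - 1# - 1#                      ≈⟨ +-congʳ (*-congˡ (-‿cong (sym u²≈-1))) ⟩
      two * - (u * u) - 1#                   ≈⟨ +-congʳ (*-congˡ (trans (-‿distribʳ-* u u) (*-congˡ (sym v≈-u)))) ⟩
      two * (u * v) - 1#                     ≈⟨ +-congʳ 2uv≈1 ⟩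
      1# - 1#                                ≈⟨ -‿inverseʳ 1# ⟩
      0#                                     ∎)

  𝒞-clique-size≤2 : ∀ m (f : Fin m → Mat) → (∀ i → InΓ̃ (f i)) → (∀ i j → i ≢ j → Adj p (f i) (f j))
                    → (i : Fin m) → InScrC (f i) → m ≤ 2
  𝒞-clique-size≤2 zero _ _ _ _ _ = z≤n
  𝒞-clique-size≤2 (suc zero) _ _ _ _ _ = s≤s z≤n
  𝒞-clique-size≤2 (suc (suc zero)) _ _ _ _ _ = s≤s (s≤s z≤n)
  𝒞-clique-size≤2 (suc (suc (suc m))) f f∈Γ̃ f-adj i (a , fᵢ≈S) = ⊥-elim
    (¬√-1-triangle (two * (b - a)) (two * (d - b))
      (proj₂ (Adj-𝒞⇒ fᵢ≈S f₁≈S (f-adj i j (j≢i ∘ ≡.sym))))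
      (proj₂ (Adj-𝒞⇒ f₁≈S f₂≈S (f-adj j l j≢l)))
      (trans (*-cong 2[b-a]+2[d-b]≈2[d-a] 2[b-a]+2[d-b]≈2[d-a]) (proj₂ (Adj-𝒞⇒ fᵢ≈S f₂≈S (f-adj i l (l≢i ∘ ≡.sym))))))
    where
    j = punchIn i Fin.zero
    l = punchIn i (Fin.suc Fin.zero)
    j≢i = FinP.punchInᵢ≢i i Fin.zero
    l≢i = FinP.punchInᵢ≢i i (Fin.suc Fin.zero)
    j≢l : j ≢ l
    j≢l eq with FinP.punchIn-injective i Fin.zero (Fin.suc Fin.zero) eq
    ... | ()
    in-𝒞 : ∀ t → t ≢ i → InScrC (f t)
    in-𝒞 t t≢i = [ (λ fₜ∈C → ⊥-elim (C∖IR-𝒞-nonadjacent (f t) (f i) fₜ∈C (a , fᵢ≈S) (f-adj t i t≢i))) , (λ fₜ∈𝒞 → fₜ∈𝒞) ] (f∈Γ̃ t)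
    b = proj₁ (in-𝒞 j j≢i)
    f₁≈S = proj₂ (in-𝒞 j j≢i)
    d = proj₁ (in-𝒞 l l≢i)
    f₂≈S = proj₂ (in-𝒞 l l≢i)
    2[b-a]+2[d-b]≈2[d-a] : two * (b - a) + two * (d - b) ≈ two * (d - a)
    2[b-a]+2[d-b]≈2[d-a] = solve 3 (λ a b d → (con (+ 1) :+ con (+ 1)) :* (b :- a) :+ (con (+ 1) :+ con (+ 1)) :* (d :- b)
                                             := (con (+ 1) :+ con (+ 1)) :* (d :- a)) refl a b d

  module _ {n : ℕ} (card : HasCard F (suc (suc n))) where
    private
      enum = proj₁ card
      enum-injective = proj₁ (proj₂ card)
      index : Carrier → Fin (suc (suc n))
      index x = proj₁ (proj₂ (proj₂ card) x)
      enum-index : ∀ x → enum (index x) ≈ x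
      enum-index x = proj₂ (proj₂ (proj₂ card) x)
      index-unique : ∀ {i x} → enum i ≈ x → i ≡ index x
      index-unique {i} {x} eᵢ≈x = enum-injective _ _ (trans eᵢ≈x (sym (enum-index x)))
      i₀≢i₁ : index 0# ≢ index 1#
      i₀≢i₁ eq = 1≉0 (trans (sym (enum-index 1#)) (trans (reflexive (≡.cong enum (≡.sym eq))) (enum-index 0#)))
      Tₑ : Fin (suc (suc n)) → Mat
      Tₑ i = T (enum i)

    C∖IR-enumeration : Enumerates InC∖IR (Tₑ ∘ skip₂ i₀≢i₁)
    C∖IR-enumeration = in-C∖IR , injective , surjective
      where
      in-C∖IR : ∀ i → InC∖IR (Tₑ (skip₂ i₀≢i₁ i))
      in-C∖IR i = (_ , ≈P-refl)
                , (λ ≈I → skip₂≢i₀ i₀≢i₁ i (index-unique (T-injective ≈I)))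
                , (λ ≈R → skip₂≢i₁ i₀≢i₁ i (index-unique (T-injective ≈R)))
      injective : ∀ i j → Tₑ (skip₂ i₀≢i₁ i) ≈P Tₑ (skip₂ i₀≢i₁ j) → i ≡ j
      injective i j Tᵢ≈Tⱼ = skip₂-injective i₀≢i₁ i j (enum-injective _ _ (T-injective Tᵢ≈Tⱼ))
      surjective : ∀ g → InC∖IR g → ∃ λ i → g ≈P Tₑ (skip₂ i₀≢i₁ i)
      surjective g ((x , g≈T) , g≉I , g≉R) =
        let (i , skip≡) = skip₂-surjective i₀≢i₁ (index x) (g≉I ∘ T≈ ∘ ≡.sym) (g≉R ∘ T≈)
        in i , ≈P-trans g≈T (≈M⇒≈P (T-cong (trans (sym (enum-index x)) (reflexive (≡.cong enum (≡.sym skip≡))))))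
        where
        T≈ : ∀ {y} → index x ≡ index y → g ≈P T y
        T≈ {y} eq = ≈P-trans g≈T (≈M⇒≈P (T-cong (trans (sym (enum-index x)) (trans (reflexive (≡.cong enum eq)) (enum-index y)))))

    C∖IR-clique-size≤n : ∀ m (f : Fin m → Mat) → (∀ i → InC∖IR (f i)) → (∀ i j → f i ≈P f j → i ≡ j) → m ≤ n
    C∖IR-clique-size≤n m f f∈C f-injective = avoiding-i₀-i₁⇒≤ i₀≢i₁ (λ i → index (x i)) index-injective
        (λ i eq → proj₁ (proj₂ (f∈C i)) (T≈ i eq)) (λ i eq → proj₂ (proj₂ (f∈C i)) (T≈ i eq))
      where
      x : Fin m → Carrier
      x i = proj₁ (proj₁ (f∈C i))
      fᵢ≈T : ∀ i → f i ≈P T (x i)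
      fᵢ≈T i = proj₂ (proj₁ (f∈C i))
      T≈ : ∀ i {y} → index (x i) ≡ index y → f i ≈P T y
      T≈ i {y} eq = ≈P-trans (fᵢ≈T i) (≈M⇒≈P (T-cong (trans (sym (enum-index (x i))) (trans (reflexive (≡.cong enum eq)) (enum-index y)))))
      index-injective : ∀ i j → index (x i) ≡ index (x j) → i ≡ j
      index-injective i j eq = f-injective i j (≈P-trans (T≈ i eq) (≈P-sym (fᵢ≈T j)))

  |C∖IR|≡N-2 : ∀ {N} → HasCard F N → HasSize InC∖IR (N ∸ 2)
  |C∖IR|≡N-2 {zero} (_ , _ , surjective) with surjective 0#
  ... | () , _
  |C∖IR|≡N-2 {suc zero} (enum , _ , surjective) with surjective 0# | surjective 1#
  ... | Fin.zero , e≈0 | Fin.zero , e≈1 = ⊥-elim (1≉0 (trans (sym e≈1) e≈0))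
  |C∖IR|≡N-2 {suc (suc n)} card = _ , C∖IR-enumeration card

  ω[Γ̃]≤N-2 : ∀ {N} → HasCard F N → 4 ≤ N → CliquesAtMost p InΓ̃ (N ∸ 2)
  ω[Γ̃]≤N-2 {suc (suc n)} card (s≤s (s≤s 2≤n)) m f f∈Γ̃ f-injective f-adj = [_,_]
    (λ f∈C → C∖IR-clique-size≤n card m f f∈C f-injective)
    (λ (i , fᵢ∈𝒞) → ℕP.≤-trans (𝒞-clique-size≤2 m f f∈Γ̃ f-adj i fᵢ∈𝒞) 2≤n)
    (all⊎any f∈Γ̃)


argmin : ∀ n (f : Fin (suc n) → ℕ) → ∃ λ j → ∀ j′ → f j ≤ f j′
argmin zero f = Fin.zero , λ { Fin.zero → ℕP.≤-refl }
argmin (suc n) f with argmin n (f ∘ Fin.suc)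
... | j , fⱼ≤ with f Fin.zero ℕ.≤? f (Fin.suc j)
...   | yes f₀≤fⱼ = Fin.zero , λ { Fin.zero → ℕP.≤-refl ; (Fin.suc j′) → ℕP.≤-trans f₀≤fⱼ (fⱼ≤ j′) }
...   | no f₀≰fⱼ = Fin.suc j , λ { Fin.zero → ℕP.<⇒≤ (ℕP.≰⇒> f₀≰fⱼ) ; (Fin.suc j′) → fⱼ≤ j′ }

lookup-injective : ∀ {A : Set} {xs : List A} → Unique xs → ∀ i j → List.lookup xs i ≡ List.lookup xs j → i ≡ j
lookup-injective (_ ∷ _) Fin.zero Fin.zero _ = ≡.refl
lookup-injective (x∉ ∷ _) Fin.zero (Fin.suc j) eq = ⊥-elim (All.lookup x∉ (∈-lookup j) eq)
lookup-injective (x∉ ∷ _) (Fin.suc i) Fin.zero eq = ⊥-elim (All.lookup x∉ (∈-lookup i) (≡.sym eq))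
lookup-injective (_ ∷ u) (Fin.suc i) (Fin.suc j) eq = ≡.cong Fin.suc (lookup-injective u i j eq)

module CycleDecomposition {c ℓ} (F : CommutativeRing c ℓ) (isField : IsField F) {q : ℕ} (card : HasCard F q)
                          {p : ℕ} (p-prime : Prime p) (5≤p : 5 ≤ p) (ιp≈0 : IntegerCoefficients.CharDivides F p) where

  open CommutativeRing F
  open PSL2 F
  open Matrices F
  open FiniteField F isField card
  open PrimeCharacteristic p-prime ιp≈0
  open Neighbourhood F isField _≟_ p-prime 5≤p ιp≈0

  p′ : ℕ
  p′ = ℕ.pred p

  p≡1+p′ : p ≡ suc p′
  p≡1+p′ = ≡.sym (ℕP.suc-pred p {{prime⇒nonZero p-prime}})

  Fin-×-count : ∀ {L n} (Φ : Fin L × Fin n → Carrier) → (∀ u v → Φ u ≈ Φ v → u ≡ v) → (∀ x → ∃ λ u → x ≈ Φ u) → L ℕ.* n ≡ q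
  Fin-×-count {L} {n} Φ Φ-injective Φ-surjective = FinP.cantor-schröder-bernstein {f = to} {g = from} to-injective from-injective
    where
    to : Fin (L ℕ.* n) → Fin q
    to a = index (Φ (remQuot n a))
    to-injective : ∀ {a b} → to a ≡ to b → a ≡ b
    to-injective {a} {b} eq = ≡.trans (≡.sym (FinP.combine-remQuot {L} n a))
      (≡.trans (≡.cong (uncurry combine) (Φ-injective _ _ (index-injective eq))) (FinP.combine-remQuot {L} n b))
    preimage : Fin q → Fin L × Fin n
    preimage i = proj₁ (Φ-surjective (enum i))
    from : Fin q → Fin (L ℕ.* n)
    from i = uncurry combine (preimage i)
    from-injective : ∀ {i j} → from i ≡ from j → i ≡ j
    from-injective {i} {j} eq = enum-injective i j
      (trans (proj₂ (Φ-surjective (enum i))) (trans (reflexive (≡.cong Φ same-preimage)) (sym (proj₂ (Φ-surjective (enum j))))))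
      where
      same-preimage : preimage i ≡ preimage j
      same-preimage = let (eq₁ , eq₂) = FinP.combine-injective (proj₁ (preimage i)) (proj₂ (preimage i)) (proj₁ (preimage j)) (proj₂ (preimage j)) eq
                      in ≡.cong₂ _,_ eq₁ eq₂

  -- Fix i with i² = -1 and let c₀ = i/2, so that S a ~ S b exactly when b - a = ±c₀. The additive translates of
  -- c₀ split F into orbits of size p, each carrying one p-cycle; an orbit is indexed by its element of least index.
  module Translates {i : Carrier} (i²≈-1 : Is√-1 i) where

    c₀ : Carrier
    c₀ = i * ½

    two*c₀≈i : two * c₀ ≈ i
    two*c₀≈i = trans (solve 3 (λ t i h → t :* (i :* h) := i :* (t :* h)) refl two i ½) (trans (*-congˡ (*-recip two two≉0)) (*-identityʳ i))

    c₀≉0 : ¬ (c₀ ≈ 0#)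
    c₀≉0 c₀≈0 = 1≉0 (begin
      1#            ≈⟨ sym (-‿involutive 1#) ⟩
      - - 1#        ≈⟨ -‿cong (sym i²≈-1) ⟩
      - (i * i)     ≈⟨ -‿cong (*-congˡ (trans (sym two*c₀≈i) (trans (*-congˡ c₀≈0) (zeroʳ two)))) ⟩
      - (i * 0#)    ≈⟨ -‿cong (zeroʳ i) ⟩
      - 0#          ≈⟨ -0#≈0# ⟩
      0#            ∎)

    ⟪_⟫ : ℕ → Carrier
    ⟪ n ⟫ = ι n * c₀

    ⟪+⟫ : ∀ a b → ⟪ a ℕ.+ b ⟫ ≈ ⟪ a ⟫ + ⟪ b ⟫
    ⟪+⟫ a b = trans (*-congʳ (ι-+ a b)) (distribʳ c₀ (ι a) (ι b))

    +⟪+⟫ : ∀ x a b → (x + ⟪ a ⟫) + ⟪ b ⟫ ≈ x + ⟪ a ℕ.+ b ⟫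
    +⟪+⟫ x a b = trans (+-assoc _ _ _) (+-congˡ (sym (⟪+⟫ a b)))

    ⟪%⟫ : ∀ n → ⟪ n % suc p′ ⟫ ≈ ⟪ n ⟫
    ⟪%⟫ n = *-congʳ (sym (trans (ι-% n) (reflexive (≡.cong ι (%-cong p≡1+p′)))))
      where
      %-cong : ∀ {d d′} .{{_ : NonZero d}} .{{_ : NonZero d′}} → d ≡ d′ → n % d ≡ n % d′
      %-cong ≡.refl = ≡.refl

    ⟪d*p⟫≈0 : ∀ d → ⟪ d ℕ.* p ⟫ ≈ 0#
    ⟪d*p⟫≈0 d = trans (*-congʳ (trans (ι-* d p) (trans (*-congˡ ιp≈0) (zeroʳ (ι d))))) (zeroˡ c₀)

    ⟪_⟫ₚ : ℕ → Fin (suc p′)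
    ⟪ d ⟫ₚ = fromℕ< (m%n<n d (suc p′))

    ⟪⟪⟫ₚ⟫ : ∀ d → ⟪ toℕ ⟪ d ⟫ₚ ⟫ ≈ ⟪ d ⟫
    ⟪⟪⟫ₚ⟫ d = trans (reflexive (≡.cong ⟪_⟫ (FinP.toℕ-fromℕ< (m%n<n d (suc p′))))) (⟪%⟫ d)

    ⟪⟫-injective : ∀ (j j′ : Fin (suc p′)) → ⟪ toℕ j ⟫ ≈ ⟪ toℕ j′ ⟫ → j ≡ j′
    ⟪⟫-injective j j′ eq = FinP.toℕ-injective (ι-injective-below-p (toℕ<p j) (toℕ<p j′)
        (*-cancelˡ c₀≉0 (trans (*-comm c₀ _) (trans eq (*-comm _ c₀)))))
      where
      toℕ<p : ∀ (j : Fin (suc p′)) → toℕ j < p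
      toℕ<p j = ≡.subst (toℕ j <_) (≡.sym p≡1+p′) (FinP.toℕ<n j)

    Orbit : Carrier → Carrier → Set ℓ
    Orbit x y = ∃ λ d → y ≈ x + ⟪ d ⟫

    y+⟪b⟫≈x+⟪a⟫⇒Orbit : ∀ {x y} a b → y + ⟪ b ⟫ ≈ x + ⟪ a ⟫ → Orbit x y
    y+⟪b⟫≈x+⟪a⟫⇒Orbit {x} {y} a b eq = a ℕ.+ b ℕ.* p′ , (begin
      y                              ≈⟨ sym (trans (+-congˡ (⟪d*p⟫≈0 b)) (+-identityʳ y)) ⟩
      y + ⟪ b ℕ.* p ⟫                ≡⟨ ≡.cong (λ k → y + ⟪ k ⟫) (≡.trans (≡.cong (b ℕ.*_) p≡1+p′) (ℕP.*-suc b p′)) ⟩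
      y + ⟪ b ℕ.+ b ℕ.* p′ ⟫         ≈⟨ sym (+⟪+⟫ y b (b ℕ.* p′)) ⟩
      (y + ⟪ b ⟫) + ⟪ b ℕ.* p′ ⟫     ≈⟨ +-congʳ eq ⟩
      (x + ⟪ a ⟫) + ⟪ b ℕ.* p′ ⟫     ≈⟨ +⟪+⟫ x a (b ℕ.* p′) ⟩
      x + ⟪ a ℕ.+ b ℕ.* p′ ⟫         ∎)

    Orbit-sym : ∀ {x y} → Orbit x y → Orbit y x
    Orbit-sym {x} {y} (d , y≈x+⟪d⟫) = y+⟪b⟫≈x+⟪a⟫⇒Orbit 0 d (trans (sym y≈x+⟪d⟫) (sym (trans (+-congˡ (zeroˡ c₀)) (+-identityʳ y))))

    Canonical : Carrier → Set
    Canonical x = ∀ (j : Fin (suc p′)) → index x Fin.≤ index (x + ⟪ toℕ j ⟫)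

    canonical? : ∀ x → Dec (Canonical x)
    canonical? x = FinP.all? (λ j → index x FinP.≤? index (x + ⟪ toℕ j ⟫))

    Canonical-resp-≈ : ∀ {x y} → x ≈ y → Canonical x → Canonical y
    Canonical-resp-≈ x≈y x-canonical j = ≡.subst₂ Fin._≤_ (index-cong x≈y) (index-cong (+-congʳ x≈y)) (x-canonical j)

    Canonical∧Orbit⇒index≤ : ∀ {x y} → Canonical x → Orbit x y → index x Fin.≤ index y
    Canonical∧Orbit⇒index≤ {x} x-canonical (d , y≈x+⟪d⟫) =
      ≡.subst (index x Fin.≤_) (index-cong (trans (+-congˡ (⟪⟪⟫ₚ⟫ d)) (sym y≈x+⟪d⟫))) (x-canonical ⟪ d ⟫ₚ)

    canonical-unique : ∀ {x y} → Canonical x → Canonical y → Orbit x y → x ≈ y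
    canonical-unique x-canonical y-canonical orbit = index-injective (FinP.≤-antisym
      (Canonical∧Orbit⇒index≤ x-canonical orbit) (Canonical∧Orbit⇒index≤ y-canonical (Orbit-sym orbit)))

    canonical-exists : ∀ x → ∃ λ y → Canonical y × Orbit y x
    canonical-exists x = y , y-canonical , Orbit-sym (toℕ j , refl)
      where
      least = argmin p′ (λ j → toℕ (index (x + ⟪ toℕ j ⟫)))
      j = proj₁ least
      y = x + ⟪ toℕ j ⟫
      y-canonical : Canonical y
      y-canonical j′ = ≡.subst (λ k → toℕ (index y) ≤ toℕ k) (index-cong (begin
        x + ⟪ toℕ ⟪ toℕ j ℕ.+ toℕ j′ ⟫ₚ ⟫   ≈⟨ +-congˡ (⟪⟪⟫ₚ⟫ (toℕ j ℕ.+ toℕ j′)) ⟩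
        x + ⟪ toℕ j ℕ.+ toℕ j′ ⟫            ≈⟨ sym (+⟪+⟫ x (toℕ j) (toℕ j′)) ⟩
        y + ⟪ toℕ j′ ⟫                      ∎)) (proj₂ least ⟪ toℕ j ℕ.+ toℕ j′ ⟫ₚ)

    canonicals : List (Fin q)
    canonicals = List.filter (canonical? ∘ enum) (List.allFin q)

    L : ℕ
    L = length canonicals

    rep : Fin L → Carrier
    rep r = enum (List.lookup canonicals r)

    rep-canonical : ∀ r → Canonical (rep r)
    rep-canonical r = All.lookup (all-filter (canonical? ∘ enum) (List.allFin q)) (∈-lookup r)

    rep-injective : ∀ r r′ → rep r ≈ rep r′ → r ≡ r′
    rep-injective r r′ eq = lookup-injective (Unique.filter⁺ (canonical? ∘ enum) (Unique.allFin⁺ q)) r r′ (enum-injective _ _ eq)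

    rep-surjective : ∀ y → Canonical y → ∃ λ r → rep r ≈ y
    rep-surjective y y-canonical = Any.index y∈ , trans (reflexive (≡.cong enum (≡.sym (lookup-index y∈)))) (enum-index y)
      where
      y∈ : index y ∈ canonicals
      y∈ = ∈-filter⁺ (canonical? ∘ enum) (∈-allFin (index y)) (Canonical-resp-≈ (sym (enum-index y)) y-canonical)

    Φ : Fin L × Fin (suc p′) → Carrier
    Φ (r , j) = rep r + ⟪ toℕ j ⟫

    Φ-injective : ∀ u v → Φ u ≈ Φ v → u ≡ v
    Φ-injective (r , j) (r′ , j′) eq = ≡.cong₂ _,_ r≡r′ (⟪⟫-injective j j′ (+-cancelˡ (trans eq (+-congʳ (reflexive (≡.cong rep (≡.sym r≡r′)))))))
      where
      r≡r′ : r ≡ r′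
      r≡r′ = rep-injective r r′ (canonical-unique (rep-canonical r) (rep-canonical r′) (y+⟪b⟫≈x+⟪a⟫⇒Orbit (toℕ j) (toℕ j′) (sym eq)))
      +-cancelˡ : ∀ {a b b′} → a + b ≈ a + b′ → b ≈ b′
      +-cancelˡ {a} {b} {b′} eq′ = trans (solve 2 (λ a b → b := :- a :+ (a :+ b)) refl a b)
                                     (trans (+-congˡ eq′) (solve 2 (λ a b → :- a :+ (a :+ b) := b) refl a b′))

    Φ-surjective : ∀ x → ∃ λ u → x ≈ Φ u
    Φ-surjective x = (r , ⟪ d ⟫ₚ) , trans x≈y+⟪d⟫ (+-cong (sym rep≈y) (sym (⟪⟪⟫ₚ⟫ d)))
      where
      y = proj₁ (canonical-exists x)
      d = proj₁ (proj₂ (proj₂ (canonical-exists x)))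
      x≈y+⟪d⟫ = proj₂ (proj₂ (proj₂ (canonical-exists x)))
      r = proj₁ (rep-surjective y (proj₁ (proj₂ (canonical-exists x))))
      rep≈y = proj₂ (rep-surjective y (proj₁ (proj₂ (canonical-exists x))))

    L*p≡q : L ℕ.* p ≡ q
    L*p≡q = ≡.trans (≡.cong (L ℕ.*_) p≡1+p′) (Fin-×-count Φ Φ-injective Φ-surjective)

    Φ-next : ∀ r j → Φ (r , next j) ≈ Φ (r , j) + c₀
    Φ-next r j = begin
      rep r + ⟪ toℕ ⟪ suc (toℕ j) ⟫ₚ ⟫   ≈⟨ +-congˡ (⟪⟪⟫ₚ⟫ (suc (toℕ j))) ⟩
      rep r + ⟪ suc (toℕ j) ⟫            ≡⟨ ≡.cong (λ k → rep r + ⟪ k ⟫) (ℕP.+-comm 1 (toℕ j)) ⟩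
      rep r + ⟪ toℕ j ℕ.+ 1 ⟫            ≈⟨ sym (+⟪+⟫ (rep r) (toℕ j) 1) ⟩
      (rep r + ⟪ toℕ j ⟫) + 1# * c₀      ≈⟨ +-congˡ (*-identityˡ c₀) ⟩
      (rep r + ⟪ toℕ j ⟫) + c₀           ∎

    Φ≈Φ+c₀⇒next : ∀ r j r′ j′ → Φ (r′ , j′) ≈ Φ (r , j) + c₀ → r ≡ r′ × j′ ≡ next j
    Φ≈Φ+c₀⇒next r j r′ j′ eq = let eq′ = Φ-injective (r′ , j′) (r , next j) (trans eq (sym (Φ-next r j)))
                                in ≡.sym (≡.cong proj₁ eq′) , ≡.cong proj₂ eq′

    Adj⇔neighbours : ∀ r j r′ j′ → (Adj p (S (Φ (r , j))) (S (Φ (r′ , j′))) → r ≡ r′ × (j′ ≡ next j ⊎ j ≡ next j′))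
                                 × (r ≡ r′ × (j′ ≡ next j ⊎ j ≡ next j′) → Adj p (S (Φ (r , j))) (S (Φ (r′ , j′))))
    Adj⇔neighbours r j r′ j′ = Adj⇒neighbours , neighbours⇒Adj
      where
      a = Φ (r , j)
      b = Φ (r′ , j′)
      two*[b-a]≈±i⇒ : two * (b - a) ≈ i ⊎ two * (b - a) ≈ - i → r ≡ r′ × (j′ ≡ next j ⊎ j ≡ next j′)
      two*[b-a]≈±i⇒ (inj₁ ≈i) = let (r≡r′ , j′≡) = Φ≈Φ+c₀⇒next r j r′ j′ (b-a≈c₀⇒ (*-cancelˡ two≉0 (trans ≈i (sym two*c₀≈i))))
                                in r≡r′ , inj₁ j′≡
        where
        b-a≈c₀⇒ : b - a ≈ c₀ → b ≈ a + c₀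
        b-a≈c₀⇒ b-a≈c₀ = trans (solve 2 (λ a b → b := a :+ (b :- a)) refl a b) (+-congˡ b-a≈c₀)
      two*[b-a]≈±i⇒ (inj₂ ≈-i) = let (r′≡r , j≡) = Φ≈Φ+c₀⇒next r′ j′ r j (a-b≈c₀⇒ (*-cancelˡ two≉0 (trans 2[a-b]≈i (sym two*c₀≈i))))
                                 in ≡.sym r′≡r , inj₂ j≡
        where
        2[a-b]≈i : two * (a - b) ≈ i
        2[a-b]≈i = trans (solve 3 (λ t a b → t :* (a :- b) := :- (t :* (b :- a))) refl two a b) (trans (-‿cong ≈-i) (-‿involutive i))
        a-b≈c₀⇒ : a - b ≈ c₀ → a ≈ b + c₀
        a-b≈c₀⇒ a-b≈c₀ = trans (solve 2 (λ a b → a := b :+ (a :- b)) refl a b) (+-congˡ a-b≈c₀)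
      Adj⇒neighbours : Adj p (S a) (S b) → r ≡ r′ × (j′ ≡ next j ⊎ j ≡ next j′)
      Adj⇒neighbours adj = two*[b-a]≈±i⇒ (x*x≈y*y⇒x≈y⊎x≈-y (trans (proj₂ (Adj-𝒞⇒ ≈P-refl ≈P-refl adj)) (sym i²≈-1)))
      neighbours⇒Adj : r ≡ r′ × (j′ ≡ next j ⊎ j ≡ next j′) → Adj p (S a) (S b)
      neighbours⇒Adj (≡.refl , inj₁ ≡.refl) = ⇒Adj-𝒞 ≈P-refl ≈P-refl
        (λ a≈b → c₀≉0 (trans (sym b-a≈c₀) (trans (+-congʳ (sym a≈b)) (-‿inverseʳ a))))
        (trans (*-cong 2[b-a]≈i 2[b-a]≈i) i²≈-1)
        where
        b-a≈c₀ : b - a ≈ c₀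
        b-a≈c₀ = trans (+-congʳ (Φ-next r j)) (solve 2 (λ a c → a :+ c :- a := c) refl a c₀)
        2[b-a]≈i = trans (*-congˡ b-a≈c₀) two*c₀≈i
      neighbours⇒Adj (≡.refl , inj₂ ≡.refl) = ⇒Adj-𝒞 ≈P-refl ≈P-refl
        (λ a≈b → c₀≉0 (trans (sym a-b≈c₀) (trans (+-congʳ a≈b) (-‿inverseʳ b))))
        (trans (*-cong 2[b-a]≈-i 2[b-a]≈-i) (trans (solve 1 (λ i → :- i :* :- i := i :* i) refl i) i²≈-1))
        where
        a-b≈c₀ : a - b ≈ c₀
        a-b≈c₀ = trans (+-congʳ (Φ-next r j′)) (solve 2 (λ b c → b :+ c :- b := c) refl b c₀)
        2[b-a]≈-i : two * (b - a) ≈ - i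
        2[b-a]≈-i = trans (solve 3 (λ t a b → t :* (b :- a) := :- (t :* (a :- b))) refl two a b) (-‿cong (trans (*-congˡ a-b≈c₀) two*c₀≈i))

    𝒞-cycles : CycleUnion p InScrC L
    𝒞-cycles = p′ , p≡1+p′ , S ∘ Φ
             , ((λ u → Φ u , ≈P-refl) , (λ u v Su≈Sv → Φ-injective u v (S-injective Su≈Sv))
               , (λ g (x , g≈S) → let (u , x≈Φu) = Φ-surjective x in u , ≈P-trans g≈S (≈M⇒≈P (S-cong x≈Φu))))
             , Adj⇔neighbours


k%2≡1⇒k≡1+[k∸1] : ∀ {k} → k % 2 ≡ 1 → k ≡ suc (k ∸ 1)
k%2≡1⇒k≡1+[k∸1] {suc k} _ = ≡.refl

open import Data.Nat using (_^_)

lemma3p4 : {c ℓ : Level} (F : CommutativeRing c ℓ) → IsField F →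
    (p k q : ℕ) → Prime p → 5 ≤ p → k % 2 ≡ 1 → q ≡ p ^ k → HasCard F q →
    let open PSL2 F in
    -- N_Γ(R) = (C ∖ {I, R}) ∪ 𝒞
    (∀ g → (InCp p g × Adj p R g) ⇔ InΓ̃ g)
    -- Γ̃ is the disjoint union of Γ[C ∖ {I,R}] and Γ[𝒞]: disjoint vertex sets, no edges between
    × (∀ g h → InC∖IR g → InScrC h → ¬ (g ≈P h))
    × (∀ g h → InC∖IR g → InScrC h → ¬ Adj p g h)
    -- Γ[C ∖ {I,R}] is a clique of size q - 2
    × IsClique p InC∖IR × HasSize InC∖IR (q ∸ 2)
    -- q ≡ 1 mod 4: Γ[𝒞] is a disjoint union of q/p cycles of length p
    × (q % 4 ≡ 1 → CycleUnion p InScrC (p ^ (k ∸ 1)))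
    -- q ≡ 3 mod 4: Γ[𝒞] has no edges
    × (q % 4 ≡ 3 → ∀ g h → InScrC g → InScrC h → ¬ Adj p g h)
    -- clique number of Γ̃ is q - 2
    × (HasSize InC∖IR (q ∸ 2) × IsClique p InC∖IR × CliquesAtMost p InΓ̃ (q ∸ 2))
lemma3p4 F isField p k q p-prime 5≤p k%2≡1 q≡pᵏ card =
    N[R]⇔InΓ̃ , C∖IR∩𝒞≡∅ , C∖IR-𝒞-nonadjacent , C∖IR-clique , |C∖IR|≡N-2 card
  , 𝒞-cycles , 𝒞-edgeless , |C∖IR|≡N-2 card , C∖IR-clique , ω[Γ̃]≤N-2 card 4≤q
  where
  open PSL2 F
  open FiniteField F isField card using (_≟_; q≡pᵏ⇒ιp≈0)
  open SquareRootsOfMinusOne F isField card using (q≡1[4]⇒∃i²≈-1; q≡3[4]⇒i²≉-1)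
  p·1≈0 = q≡pᵏ⇒ιp≈0 {p} {k} q≡pᵏ
  open Neighbourhood F isField _≟_ p-prime 5≤p p·1≈0
  open CliqueNumber F isField _≟_ p-prime 5≤p p·1≈0
  open CycleDecomposition F isField card p-prime 5≤p p·1≈0 using (module Translates)
  instance _ = prime⇒nonZero p-prime

  q≡pᵏ⁻¹*p : q ≡ p ^ (k ∸ 1) ℕ.* p
  q≡pᵏ⁻¹*p = ≡.trans q≡pᵏ (≡.trans (≡.cong (p ^_) (k%2≡1⇒k≡1+[k∸1] {k} k%2≡1)) (ℕP.*-comm p (p ^ (k ∸ 1))))

  4≤q : 4 ≤ q
  4≤q = ℕP.≤-trans (ℕP.≤-trans (ℕP.n≤1+n 4) 5≤p) (≡.subst (p ≤_) (≡.sym q≡pᵏ⁻¹*p) (ℕP.m≤n*m p (p ^ (k ∸ 1)) {{ℕP.m^n≢0 p (k ∸ 1)}}))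

  𝒞-cycles : q % 4 ≡ 1 → CycleUnion p InScrC (p ^ (k ∸ 1))
  𝒞-cycles q%4≡1 = ≡.subst (CycleUnion p InScrC) (ℕP.*-cancelʳ-≡ L (p ^ (k ∸ 1)) p (≡.trans L*p≡q q≡pᵏ⁻¹*p)) T.𝒞-cycles
    where
    module T = Translates (proj₂ (q≡1[4]⇒∃i²≈-1 q%4≡1))
    open T using (L; L*p≡q)

  𝒞-edgeless : q % 4 ≡ 3 → ∀ g h → InScrC g → InScrC h → ¬ Adj p g h
  𝒞-edgeless q%4≡3 g h (a , g≈S) (b , h≈S) adj = q≡3[4]⇒i²≉-1 q%4≡3 _ (proj₂ (Adj-𝒞⇒ g≈S h≈S adj))
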